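{- Let $G$ be a finite connected simple graph with vertex set $V$ and automorphism group $\Gamma$, and let $R$ be a complete set of representatives of the unlabeled imbeddings of $G$. Let $Y$ be a set, each element $y\in Y$ having a weight $\mathrm{wt}(y)=(p_1,\dots,p_n)\in\mathbb{Z}_{\ge 0}^n$, with finitely many elements of each weight, and let $f(w_1,\dots,w_n)=\sum_{y\in Y} w_1^{p_1(y)}\cdots w_n^{p_n(y)}$ be the figure counting series. For a function $c:V\to Y$ define its weight $W(c)=\prod_{v\in V} w_1^{p_1(c(v))}\cdots w_n^{p_n(c(v))}$. For each $M\in R$, the group $\Gamma_M(G)$ acts on the functions $V\to Y$ by $(\gamma c)(v)=c(\gamma^{ -1}(v))$; the orbits are the configurations of $M$, and $W$ is constant on each configuration. Then \[ Z(G;f(w_1,\dots,w_n))=\sum_{M\in R}\ \sum_{\text{configurations } C \text{ of } M} W(C), \] i.e. $Z(G;f)$ enumerates by weight the configurations of $G$ among its unlabeled imbeddings. Here $Z(G;f(w_1,\dots,w_n))$ denotes the result of substituting $s_k\mapsto f(w_1^k,\dots,w_n^k)$ for every $k$ in the imbedding sum $Z(G)$.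
   Context: For a vertex $v$, $N(v)$ is the set of vertices adjacent to $v$. A rotation at $v$ is a cyclic permutation $\rho_v:N(v)\to N(v)$ (a single cycle through all of $N(v)$). A rotation system is an indexed family $\rho=\{\rho_v\}_{v\in V}$ of rotations, and a map is a pair $M=(G,\rho)$. The automorphism group $\Gamma=\Gamma(G)$ acts on maps: $\gamma$ sends $(G,\rho)$ to $(G,\rho')$ with $\rho'_{\gamma(v)}=\gamma\rho_v\gamma^{ -1}$ for all $v$. The map-automorphism group $\Gamma_M(G)$ is the stabilizer of $M$; the $\Gamma$-orbits of maps are the unlabeled imbeddings. $F(\gamma)$ is the set of maps fixed by $\gamma$. For a permutation $\gamma$ of $V$, $s(\gamma)=\prod_k s_k^{j_k}$ where $j_k$ is the number of $k$-cycles of $\gamma$ on $V$. The imbedding sum is $Z(G)=\frac{1}{|\Gamma|}\sum_{\gamma\in\Gamma}|F(\gamma)|\,s(\gamma)$. -}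

module Defs where

open import Data.Bool using (Bool; true; false; if_then_else_)
import Data.Bool.Properties as BoolP
open import Data.Nat using (ℕ; zero; suc; _+_; _*_; _∸_; _/_)
import Data.Nat as Nat
open import Data.Fin using (Fin; toℕ) renaming (_≟_ to _≟ᶠ_)
open import Data.Fin.Properties using (all?; any?)
open import Data.List using (List; []; _∷_; map; concatMap; filter; length; upTo; allFin; foldr)
open import Data.Nat.ListAction using (sum)
open import Data.List.Membership.Propositional using (_∈_)
open import Data.List.Relation.Unary.Any using () renaming (any? to anyL?)
open import Data.List.Relation.Unary.All using (All)
open import Data.List.Relation.Unary.AllPairs using (AllPairs)
open import Data.List.Relation.Unary.Unique.Propositional using (Unique)
open import Data.Vec using (Vec; []; _∷_; replicate)
import Data.Vec as Vec
open import Data.Vec.Properties using (≡-dec)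
import Data.Vec.Functional as VF
open import Data.Product using (Σ; ∃; _×_; _,_; proj₁; proj₂)
open import Data.Integer using (+_)
open import Data.Rational using (ℚ; 0ℚ) renaming (_/_ to _/ℚ_)
open import Relation.Nullary using (¬_; Dec; yes; no; does)
open import Relation.Nullary.Decidable using (_×-dec_; _→-dec_; ¬?)
open import Relation.Binary.Definitions using (DecidableEquality)
open import Relation.Binary.PropositionalEquality using (_≡_; refl)

iter : ∀ {A : Set} → (A → A) → ℕ → A → A
iter f zero    x = x
iter f (suc k) x = f (iter f k x)

allFuns : ∀ {A : Set} (k : ℕ) → List A → List (Fin k → A)
allFuns zero    xs = (λ ()) ∷ []
allFuns (suc k) xs = concatMap (λ x → map (λ g → x VF.∷ g) (allFuns k xs)) xs

count : ∀ {m} {P : Fin m → Set} → (∀ i → Dec (P i)) → ℕ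
count P? = length (filter P? (allFin _))

-- number of equivalence classes met by a list in which every element
-- occurs once: an element is counted iff no later element is equivalent
countClasses : ∀ {A : Set} {_~_ : A → A → Set} →
               (∀ x y → Dec (x ~ y)) → List A → ℕ
countClasses _~?_ []       = 0
countClasses _~?_ (x ∷ xs) =
  (if does (anyL? (x ~?_) xs) then 0 else 1) + countClasses _~?_ xs

-- rational quotient m / d (d is always ≥ 1 where used)
_÷_ : ℕ → ℕ → ℚ
m ÷ zero  = 0ℚ
m ÷ suc d = (+ m) /ℚ suc d

record Graph (N : ℕ) : Set where
  field
    E      : Fin N → Fin N → Bool
    sym    : ∀ u v → E u v ≡ E v u
    irrefl : ∀ v → E v v ≡ false

open Graph public

data Walk {N} (G : Graph N) : Fin N → Fin N → Set where
  here : ∀ {v} → Walk G v v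
  step : ∀ {u w v} → E G u w ≡ true → Walk G w v → Walk G u v

Connected : ∀ {N} → Graph N → Set
Connected G = ∀ u v → Walk G u v

_≟ᵇ_ : DecidableEquality Bool
_≟ᵇ_ = BoolP._≟_

IsAut : ∀ {N} → Graph N → (Fin N → Fin N) → Set
IsAut G γ = (∀ u v → γ u ≡ γ v → u ≡ v)
          × (∀ v → ∃ λ u → γ u ≡ v)
          × (∀ u v → E G (γ u) (γ v) ≡ E G u v)

IsAut? : ∀ {N} (G : Graph N) γ → Dec (IsAut G γ)
IsAut? G γ =
  all? (λ u → all? λ v → (γ u ≟ᶠ γ v) →-dec (u ≟ᶠ v))
  ×-dec all? (λ v → any? λ u → γ u ≟ᶠ v)
  ×-dec all? (λ u → all? λ v → E G (γ u) (γ v) ≟ᵇ E G u v)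

Aut : ∀ {N} → Graph N → List (Fin N → Fin N)
Aut {N} G = filter (IsAut? G) (allFuns N (allFin N))

-- Rotation systems / maps.
-- ρ v : N(v) → N(v) is encoded as a total function Fin N → Fin N which
-- is the identity outside N(v) (so the encoding is a bijection with
-- rotation systems in the sense of the paper).

RotSys : ℕ → Set
RotSys N = Fin N → Fin N → Fin N

IsMap : ∀ {N} → Graph N → RotSys N → Set
IsMap {N} G ρ =
    (∀ v u → E G v u ≡ false → ρ v u ≡ u)
  × (∀ v u → E G v u ≡ true → E G v (ρ v u) ≡ true)
  × (∀ v u u′ → E G v u ≡ true → E G v u′ ≡ true → ρ v u ≡ ρ v u′ → u ≡ u′)
  -- single cycle through all of N(v)
  × (∀ v u u′ → E G v u ≡ true → E G v u′ ≡ true →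
       ∃ λ (k : Fin N) → iter (ρ v) (toℕ k) u ≡ u′)

IsMap? : ∀ {N} (G : Graph N) ρ → Dec (IsMap G ρ)
IsMap? {N} G ρ =
  all? (λ v → all? λ u → (E G v u ≟ᵇ false) →-dec (ρ v u ≟ᶠ u))
  ×-dec all? (λ v → all? λ u → (E G v u ≟ᵇ true) →-dec (E G v (ρ v u) ≟ᵇ true))
  ×-dec all? (λ v → all? λ u → all? λ u′ → (E G v u ≟ᵇ true) →-dec
          ((E G v u′ ≟ᵇ true) →-dec ((ρ v u ≟ᶠ ρ v u′) →-dec (u ≟ᶠ u′))))
  ×-dec all? (λ v → all? λ u → all? λ u′ → (E G v u ≟ᵇ true) →-dec
          ((E G v u′ ≟ᵇ true) →-dec any? λ k → iter (ρ v) (toℕ k) u ≟ᶠ u′))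

Maps : ∀ {N} → Graph N → List (RotSys N)
Maps {N} G = filter (IsMap? G) (allFuns N (allFuns N (allFin N)))

Sends : ∀ {N} → (Fin N → Fin N) → RotSys N → RotSys N → Set
Sends γ ρ ρ′ = ∀ v u → ρ′ (γ v) (γ u) ≡ γ (ρ v u)

Sends? : ∀ {N} γ (ρ ρ′ : RotSys N) → Dec (Sends γ ρ ρ′)
Sends? γ ρ ρ′ = all? λ v → all? λ u → ρ′ (γ v) (γ u) ≟ᶠ γ (ρ v u)

numFixed : ∀ {N} → Graph N → (Fin N → Fin N) → ℕ
numFixed G γ = length (filter (λ ρ → Sends? γ ρ ρ) (Maps G))

MapAut : ∀ {N} → Graph N → RotSys N → List (Fin N → Fin N)
MapAut G ρ = filter (λ γ → Sends? γ ρ ρ) (Aut G)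

IsImbeddingReps : ∀ {N} → Graph N → List (RotSys N) → Set
IsImbeddingReps G R =
    All (IsMap G) R
  × AllPairs (λ ρ ρ′ → ¬ (∃ λ γ → IsAut G γ × Sends γ ρ ρ′)) R
  × (∀ ρ → IsMap G ρ → ∃ λ ρ′ → ρ′ ∈ R × ∃ λ γ → IsAut G γ × Sends γ ρ′ ρ)

-- Formal power series in n variables w₁ … wₙ with ℕ coefficients,
-- represented by their coefficient function on exponent vectors.

PS : ℕ → Set
PS n = Vec ℕ n → ℕ

splits : ∀ {n} → Vec ℕ n → List (Vec ℕ n × Vec ℕ n)
splits []      = ([] , []) ∷ []
splits (x ∷ e) = concatMap (λ i → map (λ ab → (i ∷ proj₁ ab) , ((x ∸ i) ∷ proj₂ ab)) (splits e))
                           (upTo (suc x))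

_≟ᵛ_ : ∀ {n} → DecidableEquality (Vec ℕ n)
_≟ᵛ_ = ≡-dec Nat._≟_

onePS : ∀ {n} → PS n
onePS e = if does (e ≟ᵛ replicate _ 0) then 1 else 0

_⊛_ : ∀ {n} → PS n → PS n → PS n
(A ⊛ B) e = sum (map (λ ab → A (proj₁ ab) * B (proj₂ ab)) (splits e))

_^ᵖ_ : ∀ {n} → PS n → ℕ → PS n
A ^ᵖ zero  = onePS
A ^ᵖ suc m = A ⊛ (A ^ᵖ m)

-- substitution wᵢ ↦ wᵢᵏ :  A(w₁ᵏ, …, wₙᵏ)
dilate : ∀ {n} → ℕ → PS n → PS n
dilate k A e = sum (map (λ ab → if does (Vec.map (k *_) (proj₁ ab) ≟ᵛ e) then A (proj₁ ab) else 0)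
                        (splits e))

record FigureSet (n : ℕ) : Set₁ where
  field
    Y        : Set
    _≟Y_     : DecidableEquality Y
    wt       : Y → Vec ℕ n
    fiber    : Vec ℕ n → List Y
    fiber-complete : ∀ y → y ∈ fiber (wt y)
    fiber-sound    : ∀ p y → y ∈ fiber p → wt y ≡ p
    fiber-unique   : ∀ p → Unique (fiber p)

open FigureSet public

figSeries : ∀ {n} → FigureSet n → PS n
figSeries F p = length (fiber F p)

-- v lies on a cycle of γ of length (suc i)
OnCycle : ∀ {N} → (Fin N → Fin N) → ℕ → Fin N → Set
OnCycle γ i v = iter γ (suc i) v ≡ v × (∀ (m : Fin i) → ¬ (iter γ (suc (toℕ m)) v ≡ v))

OnCycle? : ∀ {N} γ i (v : Fin N) → Dec (OnCycle γ i v)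
OnCycle? γ i v = (iter γ (suc i) v ≟ᶠ v) ×-dec all? (λ m → ¬? (iter γ (suc (toℕ m)) v ≟ᶠ v))

numCycles : ∀ {N} → (Fin N → Fin N) → ℕ → ℕ
numCycles γ i = count (OnCycle? γ i) / suc i

-- s(γ) with s_k ↦ f(w₁ᵏ, …, wₙᵏ)   (cycle lengths are ≤ N)
substCycleIndex : ∀ {N n} → PS n → (Fin N → Fin N) → PS n
substCycleIndex {N} f γ =
  foldr (λ i acc → (dilate (suc i) f ^ᵖ numCycles γ i) ⊛ acc) onePS (upTo N)

ZCoeff : ∀ {N n} → Graph N → FigureSet n → Vec ℕ n → ℚ
ZCoeff G F e =
  sum (map (λ γ → numFixed G γ * substCycleIndex (figSeries F) γ e) (Aut G))
  ÷ length (Aut G)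

W : ∀ {N n} (F : FigureSet n) → (Fin N → Y F) → Vec ℕ n
W {zero}  F c = replicate _ 0
W {suc N} F c = Vec.zipWith _+_ (wt F (c Fin.zero)) (W F (λ v → c (Fin.suc v)))
  where import Data.Fin as Fin

colorings : ∀ {n} (F : FigureSet n) (k : ℕ) → Vec ℕ n → List (Fin k → Y F)
colorings F zero    e = if does (e ≟ᵛ replicate _ 0) then (λ ()) ∷ [] else []
colorings F (suc k) e =
  concatMap (λ ab → concatMap (λ y → map (λ c → y VF.∷ c) (colorings F k (proj₂ ab)))
                              (fiber F (proj₁ ab)))
            (splits e)

SameConfig : ∀ {N n} (G : Graph N) (F : FigureSet n) → RotSys N →
             (Fin N → Y F) → (Fin N → Y F) → Set
SameConfig G F ρ c c′ =
  Data.List.Relation.Unary.Any.Any (λ γ → ∀ u → c′ (γ u) ≡ c u) (MapAut G ρ)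
  where import Data.List.Relation.Unary.Any

SameConfig? : ∀ {N n} (G : Graph N) (F : FigureSet n) ρ c c′ → Dec (SameConfig G F ρ c c′)
SameConfig? G F ρ c c′ = anyL? (λ γ → all? λ u → _≟Y_ F (c′ (γ u)) (c u)) (MapAut G ρ)

numConfigs : ∀ {N n} → Graph N → FigureSet n → RotSys N → Vec ℕ n → ℕ
numConfigs {N} G F ρ e = countClasses (SameConfig? G F ρ) (colorings F N e)

{-# OPTIONS --safe #-}
-- For one automorphism γ, substituting f(w^k) for s_k in s(γ) counts the colorings fixed by γ
-- (Pólya): a fixed coloring is constant on the cycles of γ, i.e. a choice of one figure per cycle,
-- and a cycle of length k contributes f(w^k). Hence the numerator of Z(G; f) is the sum, over the
-- maps ρ, of Σ_{γ ∈ Γ_ρ} |Fix γ|. This quantity is invariant under conjugation, so it is constant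
-- on the Γ-orbit of a representative M, which has |Γ| / |Γ_M| elements; and by Burnside's lemma
-- for Γ_M it equals |Γ_M| times the number of configurations of M. So the numerator is |Γ| times
-- the number of configurations, counted over M ∈ R.
--
-- Identities between power series (the laws of ⊛, Pólya's formula) are proved bijectively: a
-- series is the length of a repetition-free enumeration, by weight, of a set with a decidable
-- equivalence, and ⊛ is realised by pairing.
module Submission where

open import Level using (0ℓ)
open import Function using (_∘_; id)
open import Algebra.Bundles using (CommutativeMonoid)
import Algebra.Properties.CommutativeSemigroup as CommSemigroupProperties
open import Data.Empty using (⊥; ⊥-elim)
open import Data.Unit using (⊤; tt)
import Data.Unit.Properties as ⊤
open import Data.Bool using (Bool; true; false; if_then_else_; T)
open import Data.Maybe using (Maybe; just; nothing; maybe)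
import Data.Maybe as Maybe
open import Data.Product using (∃; _×_; _,_; proj₁; proj₂)
import Data.Product.Properties as Product
open import Data.Product.Relation.Binary.Pointwise.NonDependent using (×-decSetoid)
open import Data.Sum using (inj₁; inj₂)
open import Data.Nat using (ℕ; zero; suc; _+_; _*_; _∸_; _≤_; _<_; s≤s; z≤n; _≟_) renaming (_/_ to _/ℕ_)
import Data.Nat.Properties as ℕ
open import Data.Nat.DivMod using (m*n/n≡m)
open import Data.Nat.ListAction using (sum)
open import Data.Integer using (+_)
import Data.Integer as ℤ
import Data.Integer.Properties as ℤₚ
open import Data.Rational using (_/_)
open import Data.Rational.Properties using (fromℚᵘ-cong)
import Data.Rational.Unnormalised as ℚᵘ
open import Data.Fin using (Fin; zero; suc; toℕ; fromℕ<) renaming (_≟_ to _≟ᶠ_)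
open import Data.Fin.Properties
  using (all?; any?; toℕ<n; toℕ-fromℕ<; toℕ-inject; pigeonhole; ¬∀⟶∃¬-smallest)
import Data.Fin.Properties as Fin
open import Data.Vec using (Vec; []; _∷_; replicate)
import Data.Vec as Vec
import Data.Vec.Properties as Vecₚ
import Data.Vec.Functional as VF
import Data.Vec.Functional.Relation.Binary.Pointwise.Properties as Pointwise
open import Data.List using (List; []; _∷_; map; foldr; _++_; concatMap; filter; length; upTo; allFin)
open import Data.List.Properties using (map-∘; length-++; map-tabulate; length-map; length-upTo; concatMap-cong)
open import Data.List.Relation.Unary.All as All using (All; []; _∷_)
open import Data.List.Relation.Unary.Any as Any using (Any; here; there)
open import Data.List.Relation.Unary.AllPairs as AllPairs using (AllPairs; []; _∷_)
import Data.List.Relation.Unary.All.Properties as Allₚ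
import Data.List.Relation.Unary.Any.Properties as Anyₚ
import Data.List.Relation.Unary.AllPairs.Properties as AllPairsₚ
import Data.List.Relation.Unary.Unique.Setoid as UniqueSetoid
open import Data.List.Relation.Unary.Unique.Propositional.Properties using (upTo⁺; allFin⁺)
open import Data.List.Membership.Propositional.Properties using (∈-upTo⁺; ∈-upTo⁻; ∈-allFin)
import Data.List.Membership.Setoid as SetoidMembership
import Data.List.Membership.Propositional as Membership
open import Relation.Nullary using (Dec; yes; no; ¬_; does)
open import Relation.Nullary.Decidable using (¬?; decidable-stable; dec-true)
open import Relation.Binary using (tri<; tri≈; tri>)
open import Relation.Binary.Bundles using (DecSetoid)
import Relation.Binary.Reasoning.Setoid as SetoidReasoning
open import Relation.Binary.PropositionalEquality
  using (_≡_; _≢_; _≗_; refl; sym; trans; cong; cong₂; subst; module ≡-Reasoning)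
open import Relation.Binary.PropositionalEquality.Properties using (decSetoid)
open import Relation.Binary.PropositionalEquality.Algebra using (isMagma)
open import Defs hiding (sym)

concatMap-AllPairs : ∀ {A B : Set} {R : B → B → Set} (h : A → List B) {xs : List A} →
  AllPairs (λ x y → All (λ u → All (R u) (h y)) (h x)) xs → All (AllPairs R ∘ h) xs →
  AllPairs R (concatMap h xs)
concatMap-AllPairs h across within = AllPairsₚ.concat⁺ (Allₚ.map⁺ within) (AllPairsₚ.map⁺ across)

Any-filter⁺ : ∀ {A : Set} {P Q : A → Set} (P? : ∀ x → Dec (P x)) {xs : List A} →
              Any (λ x → Q x × P x) xs → Any Q (filter P? xs)
Any-filter⁺ P? {x ∷ xs} (here (q , p)) with P? x
... | yes _ = here q
... | no ¬p = ⊥-elim (¬p p)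
Any-filter⁺ P? {x ∷ xs} (there a) with P? x
... | yes _ = there (Any-filter⁺ P? a)
... | no _  = Any-filter⁺ P? a

All-filter⁺ : ∀ {A : Set} {P D : A → Set} (P? : ∀ x → Dec (P x)) {xs : List A} →
              All D xs → All (λ x → D x × P x) (filter P? xs)
All-filter⁺ P? {xs} ds = All.zip (Allₚ.filter⁺ P? ds , Allₚ.all-filter P? xs)

module ListSum {c ℓ} (M : CommutativeMonoid c ℓ) where
  open CommutativeMonoid M
    using (_≈_; _∙_; ε; ∙-cong; ∙-congˡ; assoc; identityˡ; identityʳ; setoid; commutativeSemigroup)
    renaming (Carrier to C; refl to ≈-refl; sym to ≈-sym; trans to ≈-trans)
  open CommSemigroupProperties commutativeSemigroup using (interchange)
  open SetoidReasoning setoid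

  ∑ : ∀ {A : Set} → List A → (A → C) → C
  ∑ xs f = foldr _∙_ ε (map f xs)

  infix 8 [_]·_
  [_]·_ : ∀ {P : Set} → Dec P → C → C
  [ yes _ ]· x = x
  [ no _ ]· x = ε

  ∑-cong : ∀ {A : Set} (xs : List A) {f g : A → C} → (∀ x → f x ≈ g x) → ∑ xs f ≈ ∑ xs g
  ∑-cong [] f≈g = ≈-refl
  ∑-cong (x ∷ xs) f≈g = ∙-cong (f≈g x) (∑-cong xs f≈g)

  ∑-congᴬ : ∀ {A : Set} {xs : List A} {f g : A → C} → All (λ x → f x ≈ g x) xs → ∑ xs f ≈ ∑ xs g
  ∑-congᴬ [] = ≈-refl
  ∑-congᴬ (e ∷ es) = ∙-cong e (∑-congᴬ es)

  ∑-ε : ∀ {A : Set} (xs : List A) → ∑ xs (λ _ → ε) ≈ ε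
  ∑-ε [] = ≈-refl
  ∑-ε (x ∷ xs) = ≈-trans (∙-congˡ (∑-ε xs)) (identityˡ ε)

  ∑-∙ : ∀ {A : Set} (xs : List A) (f g : A → C) → ∑ xs (λ x → f x ∙ g x) ≈ ∑ xs f ∙ ∑ xs g
  ∑-∙ [] f g = ≈-sym (identityˡ ε)
  ∑-∙ (x ∷ xs) f g = ≈-trans (∙-congˡ (∑-∙ xs f g)) (interchange _ _ _ _)

  ∑-comm : ∀ {A B : Set} (xs : List A) (ys : List B) (F : A → B → C) →
           ∑ xs (λ a → ∑ ys (F a)) ≈ ∑ ys (λ b → ∑ xs (λ a → F a b))
  ∑-comm [] ys F = ≈-sym (∑-ε ys)
  ∑-comm (x ∷ xs) ys F = ≈-trans (∙-congˡ (∑-comm xs ys F)) (≈-sym (∑-∙ ys (F x) _))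

  ∑-filter : ∀ {A : Set} {P : A → Set} (P? : ∀ x → Dec (P x)) (xs : List A) (f : A → C) →
             ∑ (filter P? xs) f ≈ ∑ xs (λ x → [ P? x ]· f x)
  ∑-filter P? [] f = ≈-refl
  ∑-filter P? (x ∷ xs) f with P? x
  ... | yes _ = ∙-congˡ (∑-filter P? xs f)
  ... | no _ = ≈-trans (∑-filter P? xs f) (≈-sym (identityˡ _))

  ∑-[]·-none : ∀ {A : Set} {Q : A → Set} (Q? : ∀ x → Dec (Q x)) {xs : List A} (F : A → C) →
               All (¬_ ∘ Q) xs → ∑ xs (λ x → [ Q? x ]· F x) ≈ ε
  ∑-[]·-none Q? F [] = ≈-refl
  ∑-[]·-none Q? {x ∷ xs} F (¬q ∷ ¬qs) with Q? x
  ... | yes q = ⊥-elim (¬q q)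
  ... | no _ = ≈-trans (identityˡ _) (∑-[]·-none Q? F ¬qs)

  ∑-[]·-single : ∀ {A : Set} {D Q : A → Set} {R : A → A → Set} (Q? : ∀ x → Dec (Q x))
                 {xs : List A} (F : A → C) {m : C} → All D xs → AllPairs R xs →
                 (∀ {x y} → D x → D y → R x y → Q x → Q y → ⊥) → Any Q xs →
                 (∀ {x} → D x → Q x → F x ≈ m) → ∑ xs (λ x → [ Q? x ]· F x) ≈ m
  ∑-[]·-single Q? {x ∷ xs} F (dx ∷ ds) (rx ∷ rs) excl any val with Q? x
  ... | yes q = ≈-trans (∙-congˡ (∑-[]·-none Q? F (All.zipWith (λ (dy , r) qy → excl dx dy r q qy) (ds , rx))))
                      (≈-trans (identityʳ _) (val dx q))
  ... | no ¬q with any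
  ...   | here q = ⊥-elim (¬q q)
  ...   | there a = ≈-trans (identityˡ _) (∑-[]·-single Q? F ds rs excl a val)

  []·-⇔ : ∀ {P Q : Set} (P? : Dec P) (Q? : Dec Q) (x : C) → (P → Q) → (Q → P) → [ P? ]· x ≡ [ Q? ]· x
  []·-⇔ (yes p) (yes q) x f g = refl
  []·-⇔ (yes p) (no ¬q) x f g = ⊥-elim (¬q (f p))
  []·-⇔ (no ¬p) (yes q) x f g = ⊥-elim (¬p (g q))
  []·-⇔ (no ¬p) (no ¬q) x f g = refl

  []·-yes : ∀ {P : Set} (P? : Dec P) (x : C) → P → [ P? ]· x ≡ x
  []·-yes (yes _) x p = refl
  []·-yes (no ¬p) x p = ⊥-elim (¬p p)

  []·-no : ∀ {P : Set} (P? : Dec P) (x : C) → ¬ P → [ P? ]· x ≡ ε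
  []·-no (yes p) x ¬p = ⊥-elim (¬p p)
  []·-no (no _) x ¬p = refl

  ∑-allFin-suc : ∀ {N} (g : Fin (suc N) → C) → ∑ (allFin (suc N)) g ≡ g zero ∙ ∑ (allFin N) (g ∘ suc)
  ∑-allFin-suc {N} g = cong (λ xs → g zero ∙ foldr _∙_ ε xs)
    (trans (map-tabulate suc g) (sym (map-tabulate id (g ∘ suc))))

module ℕ-sum where
  open ListSum ℕ.+-0-commutativeMonoid public

  ∑-*ˡ : ∀ {A : Set} (xs : List A) (k : ℕ) (f : A → ℕ) → ∑ xs (λ x → k * f x) ≡ k * ∑ xs f
  ∑-*ˡ [] k f = sym (ℕ.*-zeroʳ k)
  ∑-*ˡ (x ∷ xs) k f = trans (cong (_+_ (k * f x)) (∑-*ˡ xs k f)) (sym (ℕ.*-distribˡ-+ k (f x) _))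

  ∑-*ʳ : ∀ {A : Set} (xs : List A) (f : A → ℕ) (k : ℕ) → ∑ xs f * k ≡ ∑ xs (λ x → f x * k)
  ∑-*ʳ xs f k = trans (ℕ.*-comm (∑ xs f) k) (trans (sym (∑-*ˡ xs k f)) (∑-cong xs (λ x → ℕ.*-comm k (f x))))

  ∑-const : ∀ {A : Set} (xs : List A) (k : ℕ) → ∑ xs (λ _ → k) ≡ length xs * k
  ∑-const [] k = refl
  ∑-const (x ∷ xs) k = cong (_+_ k) (∑-const xs k)

  ∑-one : ∀ {A : Set} (xs : List A) → ∑ xs (λ _ → 1) ≡ length xs
  ∑-one [] = refl
  ∑-one (x ∷ xs) = cong suc (∑-one xs)

  length-concatMap : ∀ {A B : Set} (h : A → List B) (xs : List A) →
                     length (concatMap h xs) ≡ ∑ xs (length ∘ h)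
  length-concatMap h [] = refl
  length-concatMap h (x ∷ xs) =
    trans (length-++ (h x)) (cong (_+_ (length (h x))) (length-concatMap h xs))

  length-filter : ∀ {A : Set} {P : A → Set} (P? : ∀ x → Dec (P x)) (xs : List A) →
                  length (filter P? xs) ≡ ∑ xs (λ x → [ P? x ]· 1)
  length-filter P? xs = trans (sym (∑-one (filter P? xs))) (∑-filter P? xs (λ _ → 1))

  []·-* : ∀ {P : Set} (P? : Dec P) (k : ℕ) → [ P? ]· k ≡ ([ P? ]· 1) * k
  []·-* (yes _) k = sym (ℕ.*-identityˡ k)
  []·-* (no _) k = refl

  ∑-[]·1-* : ∀ {A : Set} {P : A → Set} (P? : ∀ x → Dec (P x)) (xs : List A) (k : ℕ) →
             ∑ xs (λ x → [ P? x ]· 1) * k ≡ ∑ xs (λ x → [ P? x ]· k)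
  ∑-[]·1-* P? xs k = trans (∑-*ʳ xs _ k) (∑-cong xs (λ x → sym ([]·-* (P? x) k)))

module _ (S : DecSetoid 0ℓ 0ℓ) where
  open DecSetoid S
  open SetoidMembership setoid using (_∈_)

  record Enumerates (P : Carrier → Set) (xs : List Carrier) : Set where
    field
      sound    : All P xs
      unique   : UniqueSetoid.Unique setoid xs
      complete : ∀ {x} → P x → x ∈ xs

module _ {S : DecSetoid 0ℓ 0ℓ} {P : DecSetoid.Carrier S → Set} {xs : List (DecSetoid.Carrier S)}
         (E : Enumerates S P xs) where
  open DecSetoid S
  open Enumerates E

  enumerates-filter : ∀ {Q : Carrier → Set} (Q? : ∀ x → Dec (Q x)) → (∀ {x y} → x ≈ y → Q x → Q y) →
                      Enumerates S (λ x → P x × Q x) (filter Q? xs)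
  enumerates-filter Q? Q-resp = record
    { sound = All-filter⁺ Q? sound
    ; unique = AllPairsₚ.filter⁺ Q? unique
    ; complete = λ (p , q) → Any-filter⁺ Q? (Any.map (λ x≈ → x≈ , Q-resp x≈ q) (complete p)) }

  enumerates-⇔ : ∀ {Q : Carrier → Set} → (∀ {x} → P x → Q x) → (∀ {x} → Q x → P x) → Enumerates S Q xs
  enumerates-⇔ P⇒Q Q⇒P = record { sound = All.map P⇒Q sound ; unique = unique ; complete = complete ∘ Q⇒P }

module _ (S₁ S₂ : DecSetoid 0ℓ 0ℓ) where
  private
    module S₁ = DecSetoid S₁
    module S₂ = DecSetoid S₂

  record Bijection (P₁ : S₁.Carrier → Set) (P₂ : S₂.Carrier → Set) : Set where
    field
      to       : S₁.Carrier → S₂.Carrier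
      from     : S₂.Carrier → S₁.Carrier
      to-cong  : ∀ {x x′} → x S₁.≈ x′ → to x S₂.≈ to x′
      from-cong : ∀ {y y′} → y S₂.≈ y′ → from y S₁.≈ from y′
      to-P     : ∀ {x} → P₁ x → P₂ (to x)
      from-P   : ∀ {y} → P₂ y → P₁ (from y)
      from∘to  : ∀ {x} → P₁ x → from (to x) S₁.≈ x
      to∘from  : ∀ {y} → P₂ y → to (from y) S₂.≈ y

module _ {c ℓ} (M : CommutativeMonoid c ℓ) {S₁ S₂ : DecSetoid 0ℓ 0ℓ} where
  open CommutativeMonoid M using (_≈_; setoid)
    renaming (Carrier to C; refl to ≈-refl; sym to ≈-sym; trans to ≈-trans)
  open SetoidReasoning setoid
  open ListSum M
  private
    module S₁ = DecSetoid S₁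
    module S₂ = DecSetoid S₂

  ∑-reindex : ∀ {P₁ P₂ xs ys} → Enumerates S₁ P₁ xs → Enumerates S₂ P₂ ys →
              (φ : Bijection S₁ S₂ P₁ P₂) (g : S₂.Carrier → C) →
              (∀ {y y′} → y S₂.≈ y′ → g y ≈ g y′) →
              ∑ xs (g ∘ Bijection.to φ) ≈ ∑ ys g
  ∑-reindex {P₁} {P₂} {xs} {ys} X Y φ g g-cong = begin
      ∑ xs (λ x → g (to x))
    ≈⟨ ∑-congᴬ (All.map picked-once (Enumerates.sound X)) ⟩
      ∑ xs (λ x → ∑ ys (λ y → [ y S₂.≟ to x ]· g y))
    ≈⟨ ∑-comm xs ys _ ⟩
      ∑ ys (λ y → ∑ xs (λ x → [ y S₂.≟ to x ]· g y))
    ≈⟨ ∑-congᴬ (All.map hit-once (Enumerates.sound Y)) ⟩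
      ∑ ys g
    ∎
    where
    open Bijection φ
    module X = Enumerates X
    module Y = Enumerates Y
    picked-once : ∀ {x} → P₁ x → g (to x) ≈ ∑ ys (λ y → [ y S₂.≟ to x ]· g y)
    picked-once {x} px = ≈-sym (∑-[]·-single (λ y → y S₂.≟ to x) g Y.sound Y.unique
      (λ _ _ y≉y′ y≈ y′≈ → y≉y′ (S₂.trans y≈ (S₂.sym y′≈)))
      (Any.map S₂.sym (Y.complete (to-P px))) (λ _ y≈ → g-cong y≈))
    hit-once : ∀ {y} → P₂ y → ∑ xs (λ x → [ y S₂.≟ to x ]· g y) ≈ g y
    hit-once {y} py = ∑-[]·-single (λ x → y S₂.≟ to x) (λ _ → g y) X.sound X.unique
      (λ px px′ x≉x′ y≈ y≈′ → x≉x′ (S₁.trans (S₁.sym (from∘to px))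
        (S₁.trans (from-cong (S₂.trans (S₂.sym y≈) y≈′)) (from∘to px′))))
      (Any.map (λ {x} x≈ → S₂.trans (S₂.sym (to∘from py)) (to-cong x≈)) (X.complete (from-P py)))
      (λ _ _ → ≈-refl)

infixl 6 _+ᵛ_
_+ᵛ_ : ∀ {n} → Vec ℕ n → Vec ℕ n → Vec ℕ n
_+ᵛ_ = Vec.zipWith _+_

0ᵛ : ∀ {n} → Vec ℕ n
0ᵛ = replicate _ 0

+ᵛ-commutativeMonoid : ℕ → CommutativeMonoid 0ℓ 0ℓ
+ᵛ-commutativeMonoid n = record
  { Carrier = Vec ℕ n ; _≈_ = _≡_ ; _∙_ = _+ᵛ_ ; ε = 0ᵛ
  ; isCommutativeMonoid = record
    { isMonoid = record
      { isSemigroup = record { isMagma = isMagma _+ᵛ_ ; assoc = Vecₚ.zipWith-assoc ℕ.+-assoc }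
      ; identity = Vecₚ.zipWith-identityˡ ℕ.+-identityˡ , Vecₚ.zipWith-identityʳ ℕ.+-identityʳ }
    ; comm = Vecₚ.zipWith-comm ℕ.+-comm } }

module +ᵛ {n : ℕ} = CommutativeMonoid (+ᵛ-commutativeMonoid n)
module +ᵛ-sum {n : ℕ} = ListSum (+ᵛ-commutativeMonoid n)

splits-sound : ∀ {n} (e : Vec ℕ n) → All (λ (a , b) → a +ᵛ b ≡ e) (splits e)
splits-sound [] = refl ∷ []
splits-sound (x ∷ e) = Allₚ.concat⁺ (Allₚ.map⁺ (All.tabulate λ i∈ → Allₚ.map⁺
  (All.map (cong₂ _∷_ (ℕ.m+[n∸m]≡n (ℕ.≤-pred (∈-upTo⁻ i∈)))) (splits-sound e))))

splits-complete : ∀ {n} (a b : Vec ℕ n) → Any (_≡ (a , b)) (splits (a +ᵛ b))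
splits-complete [] [] = here refl
splits-complete (i ∷ a) (j ∷ b) =
  Anyₚ.concatMap⁺ _ (Any.map (λ { refl → Anyₚ.map⁺ (Any.map (λ { refl → head≡ }) (splits-complete a b)) })
    (∈-upTo⁺ {n = suc (i + j)} (s≤s (ℕ.m≤m+n i j))))
  where
  head≡ : ((i ∷ a) , ((i + j ∸ i) ∷ b)) ≡ ((i ∷ a) , (j ∷ b))
  head≡ = cong (λ k → (i ∷ a) , (k ∷ b)) (ℕ.m+n∸m≡n i j)

splits-unique : ∀ {n} (e : Vec ℕ n) → AllPairs (λ p q → proj₁ p ≢ proj₁ q) (splits e)
splits-unique [] = [] ∷ []
splits-unique (x ∷ e) = concatMap-AllPairs _ (AllPairs.map (λ i≢j → across i≢j) (upTo⁺ (suc x)))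
  (All.tabulate λ {i} _ → AllPairsₚ.map⁺ (AllPairs.map (λ ne eq → ne (cong Vec.tail eq)) (splits-unique e)))
  where
  across : ∀ {i j} → i ≢ j → All (λ u → All (λ u′ → proj₁ u ≢ proj₁ u′)
             (map (λ (a , b) → (j ∷ a) , ((x ∸ j) ∷ b)) (splits e)))
             (map (λ (a , b) → (i ∷ a) , ((x ∸ i) ∷ b)) (splits e))
  across i≢j = Allₚ.map⁺ (All.tabulate λ _ → Allₚ.map⁺ (All.tabulate λ _ eq → i≢j (cong Vec.head eq)))

module _ {n : ℕ} (S : DecSetoid 0ℓ 0ℓ) where
  open DecSetoid S

  record WeightedEnumeration (P : Carrier → Set) (w : Carrier → Vec ℕ n) : Set where
    field
      w-cong     : ∀ {x y} → x ≈ y → w x ≡ w y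
      enum       : Vec ℕ n → List Carrier
      enumerates : ∀ e → Enumerates S (λ t → P t × w t ≡ e) (enum e)

    series : PS n
    series e = length (enum e)

    module _ (e : Vec ℕ n) where
      open Enumerates (enumerates e) public

module _ {S₁ S₂ : DecSetoid 0ℓ 0ℓ} where
  private
    module S₁ = DecSetoid S₁
    module S₂ = DecSetoid S₂

  enumerations-length : ∀ {P₁ P₂ xs ys} → Bijection S₁ S₂ P₁ P₂ →
                        Enumerates S₁ P₁ xs → Enumerates S₂ P₂ ys → length xs ≡ length ys
  enumerations-length {xs = xs} {ys} φ X Y = begin
    length xs        ≡⟨ sym (ℕ-sum.∑-one xs) ⟩
    ℕ-sum.∑ xs (λ _ → 1) ≡⟨ ∑-reindex ℕ.+-0-commutativeMonoid X Y φ (λ _ → 1) (λ _ → refl) ⟩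
    ℕ-sum.∑ ys (λ _ → 1) ≡⟨ ℕ-sum.∑-one ys ⟩
    length ys        ∎
    where open ≡-Reasoning

  module _ {n : ℕ} {P₁ : S₁.Carrier → Set} {P₂ : S₂.Carrier → Set}
           {w₁ : S₁.Carrier → Vec ℕ n} {w₂ : S₂.Carrier → Vec ℕ n}
           (w₂-cong : ∀ {y y′} → y S₂.≈ y′ → w₂ y ≡ w₂ y′)
           (φ : Bijection S₁ S₂ P₁ P₂) (φ-w : ∀ {x} → P₁ x → w₂ (Bijection.to φ x) ≡ w₁ x) where
    open Bijection φ

    from-w : ∀ {y} → P₂ y → w₁ (from y) ≡ w₂ y
    from-w py = trans (sym (φ-w (from-P py))) (w₂-cong (to∘from py))

    restrict : ∀ e → Bijection S₁ S₂ (λ t → P₁ t × w₁ t ≡ e) (λ t → P₂ t × w₂ t ≡ e)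
    restrict e = record
      { to = to ; from = from ; to-cong = to-cong ; from-cong = from-cong
      ; to-P = λ (p , we) → to-P p , trans (φ-w p) we
      ; from-P = λ (p , we) → from-P p , trans (from-w p) we
      ; from∘to = λ (p , _) → from∘to p ; to∘from = λ (p , _) → to∘from p }

    series-≗ : (E₁ : WeightedEnumeration S₁ P₁ w₁) (E₂ : WeightedEnumeration S₂ P₂ w₂) →
               WeightedEnumeration.series E₁ ≗ WeightedEnumeration.series E₂
    series-≗ E₁ E₂ e = enumerations-length (restrict e)
      (WeightedEnumeration.enumerates E₁ e) (WeightedEnumeration.enumerates E₂ e)

pairs : ∀ {n} {A B C : Set} → (A → B → C) → (Vec ℕ n → List A) → (Vec ℕ n → List B) → Vec ℕ n → List C
pairs pair E₁ E₂ e = concatMap (λ (a , b) → concatMap (λ x → map (pair x) (E₂ b)) (E₁ a)) (splits e)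

pairs-congʳ : ∀ {n} {A B C : Set} (pair : A → B → C) (E₁ : Vec ℕ n → List A) {E₂ E₂′ : Vec ℕ n → List B} →
              E₂ ≗ E₂′ → pairs pair E₁ E₂ ≗ pairs pair E₁ E₂′
pairs-congʳ pair E₁ E₂≗E₂′ e =
  concatMap-cong (λ (a , b) → concatMap-cong (λ x → cong (map (pair x)) (E₂≗E₂′ b)) (E₁ a)) (splits e)

module _ {n : ℕ} {S₁ S₂ S : DecSetoid 0ℓ 0ℓ} where
  private
    module S₁ = DecSetoid S₁
    module S₂ = DecSetoid S₂
    module S = DecSetoid S

  record Pairing (P₁ : S₁.Carrier → Set) (w₁ : S₁.Carrier → Vec ℕ n)
                 (P₂ : S₂.Carrier → Set) (w₂ : S₂.Carrier → Vec ℕ n)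
                 (P : S.Carrier → Set) (w : S.Carrier → Vec ℕ n) : Set where
    field
      pair           : S₁.Carrier → S₂.Carrier → S.Carrier
      fst            : S.Carrier → S₁.Carrier
      snd            : S.Carrier → S₂.Carrier
      w-cong         : ∀ {t t′} → t S.≈ t′ → w t ≡ w t′
      pair-cong      : ∀ {x x′ y y′} → x S₁.≈ x′ → y S₂.≈ y′ → pair x y S.≈ pair x′ y′
      pair-injective : ∀ {x x′ y y′} → pair x y S.≈ pair x′ y′ → x S₁.≈ x′ × y S₂.≈ y′
      pair-P         : ∀ {x y} → P₁ x → P₂ y → P (pair x y)
      pair-w         : ∀ x y → w (pair x y) ≡ w₁ x +ᵛ w₂ y
      split-P        : ∀ {t} → P t → P₁ (fst t) × P₂ (snd t)
      split-≈        : ∀ {t} → P t → t S.≈ pair (fst t) (snd t)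

  module _ {P₁ : S₁.Carrier → Set} {w₁ : S₁.Carrier → Vec ℕ n}
           {P₂ : S₂.Carrier → Set} {w₂ : S₂.Carrier → Vec ℕ n}
           {P : S.Carrier → Set} {w : S.Carrier → Vec ℕ n}
           (E₁ : WeightedEnumeration S₁ P₁ w₁) (E₂ : WeightedEnumeration S₂ P₂ w₂)
           (Π : Pairing P₁ w₁ P₂ w₂ P w) where
    private
      module E₁ = WeightedEnumeration E₁
      module E₂ = WeightedEnumeration E₂
    open Pairing Π

    private
      block : Vec ℕ n × Vec ℕ n → List S.Carrier
      block (a , b) = concatMap (λ x → map (pair x) (E₂.enum b)) (E₁.enum a)

      FirstWeight : Vec ℕ n → S.Carrier → Set
      FirstWeight a t = ∃ λ x → w₁ x ≡ a × ∃ λ y → t ≡ pair x y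

      block-first : ∀ a b → All (FirstWeight a) (block (a , b))
      block-first a b = Allₚ.concat⁺ (Allₚ.map⁺ (All.map (λ {x} (_ , wx) →
        Allₚ.map⁺ (All.universal (λ y → x , wx , y , refl) (E₂.enum b))) (E₁.sound a)))

      block-length : ∀ a b → length (block (a , b)) ≡ E₁.series a * E₂.series b
      block-length a b = begin
        length (block (a , b))                              ≡⟨ ℕ-sum.length-concatMap _ (E₁.enum a) ⟩
        ℕ-sum.∑ (E₁.enum a) (λ x → length (map (pair x) (E₂.enum b)))
          ≡⟨ ℕ-sum.∑-cong (E₁.enum a) (λ x → length-map (pair x) (E₂.enum b)) ⟩
        ℕ-sum.∑ (E₁.enum a) (λ _ → E₂.series b)              ≡⟨ ℕ-sum.∑-const (E₁.enum a) _ ⟩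
        E₁.series a * E₂.series b                          ∎
        where open ≡-Reasoning

      sound : ∀ e → All (λ t → P t × w t ≡ e) (pairs pair E₁.enum E₂.enum e)
      sound e = Allₚ.concat⁺ (Allₚ.map⁺ (All.map (λ {(a , b)} a+b≡e →
        Allₚ.concat⁺ (Allₚ.map⁺ (All.map (λ {x} (px , wx) →
          Allₚ.map⁺ (All.map (λ {y} (py , wy) →
            pair-P px py , trans (pair-w x y) (trans (cong₂ _+ᵛ_ wx wy) a+b≡e)) (E₂.sound b)))
          (E₁.sound a)))) (splits-sound e)))

      complete : ∀ {t} → P t → Any (t S.≈_) (pairs pair E₁.enum E₂.enum (w t))
      complete {t} pt with split-P pt
      ... | p₁ , p₂ = subst (λ e → Any (t S.≈_) (pairs pair E₁.enum E₂.enum e))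
        (sym (trans (w-cong (split-≈ pt)) (pair-w _ _)))
        (Anyₚ.concatMap⁺ _ (Any.map (λ { refl → Anyₚ.concatMap⁺ _ (Any.map (λ x≈ →
          Anyₚ.map⁺ (Any.map (λ y≈ → S.trans (split-≈ pt) (pair-cong x≈ y≈))
            (E₂.complete _ (p₂ , refl)))) (E₁.complete _ (p₁ , refl))) })
          (splits-complete (w₁ (fst t)) (w₂ (snd t)))))

      unique : ∀ e → AllPairs (λ t t′ → ¬ t S.≈ t′) (pairs pair E₁.enum E₂.enum e)
      unique e = concatMap-AllPairs _ (AllPairs.map (λ {ab} {ab′} → across ab ab′) (splits-unique e))
                   (All.universal within (splits e))
        where
        across : ∀ ab ab′ → proj₁ ab ≢ proj₁ ab′ →
                 All (λ u → All (λ u′ → ¬ u S.≈ u′) (block ab′)) (block ab)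
        across (a , b) (a′ , b′) a≢a′ = All.map (λ { (x , wx , y , refl) → All.map
          (λ { (x′ , wx′ , y′ , refl) pair≈ → a≢a′
               (trans (sym wx) (trans (E₁.w-cong (proj₁ (pair-injective pair≈))) wx′)) })
          (block-first a′ b′) }) (block-first a b)
        within : ∀ ab → AllPairs (λ t t′ → ¬ t S.≈ t′) (block ab)
        within (a , b) = concatMap-AllPairs _
          (AllPairs.map (λ x≉x′ → Allₚ.map⁺ (All.universal (λ y → Allₚ.map⁺ (All.universal
             (λ y′ pair≈ → x≉x′ (proj₁ (pair-injective pair≈))) _)) _)) (E₁.unique a))
          (All.universal (λ x → AllPairsₚ.map⁺ (AllPairs.map
             (λ y≉y′ pair≈ → y≉y′ (proj₂ (pair-injective pair≈)))
             (E₂.unique b))) (E₁.enum a))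

    pairEnumeration : WeightedEnumeration S P w
    pairEnumeration = record
      { w-cong = w-cong
      ; enum = pairs pair E₁.enum E₂.enum
      ; enumerates = λ e → record
        { sound = sound e
        ; unique = unique e
        ; complete = λ { (pt , refl) → complete pt } } }

    series-pairEnumeration : WeightedEnumeration.series pairEnumeration ≗ E₁.series ⊛ E₂.series
    series-pairEnumeration e = trans (ℕ-sum.length-concatMap block (splits e))
      (ℕ-sum.∑-cong (splits e) (λ (a , b) → block-length a b))

module _ {n : ℕ} {S₁ S₂ : DecSetoid 0ℓ 0ℓ} {P₁ : DecSetoid.Carrier S₁ → Set} {P₂ : DecSetoid.Carrier S₂ → Set}
         {w₁ : DecSetoid.Carrier S₁ → Vec ℕ n}
         {w₂ : DecSetoid.Carrier S₂ → Vec ℕ n}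
         (E₁ : WeightedEnumeration S₁ P₁ w₁) (E₂ : WeightedEnumeration S₂ P₂ w₂) where
  private
    module S₁ = DecSetoid S₁
    module S₂ = DecSetoid S₂

  ×-pairing : Pairing {S₁ = S₁} {S₂} {×-decSetoid S₁ S₂} P₁ w₁ P₂ w₂
                      (λ (x , y) → P₁ x × P₂ y) (λ (x , y) → w₁ x +ᵛ w₂ y)
  ×-pairing = record
    { pair = _,_ ; fst = proj₁ ; snd = proj₂
    ; w-cong = λ (x≈ , y≈) → cong₂ _+ᵛ_ (WeightedEnumeration.w-cong E₁ x≈) (WeightedEnumeration.w-cong E₂ y≈)
    ; pair-cong = _,_ ; pair-injective = λ p → p
    ; pair-P = _,_ ; pair-w = λ _ _ → refl
    ; split-P = λ p → p ; split-≈ = λ _ → S₁.refl , S₂.refl }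

  infixr 7 _×ᵉ_
  _×ᵉ_ : WeightedEnumeration (×-decSetoid S₁ S₂) (λ (x , y) → P₁ x × P₂ y) (λ (x , y) → w₁ x +ᵛ w₂ y)
  _×ᵉ_ = pairEnumeration E₁ E₂ ×-pairing

module _ {n : ℕ} (S : DecSetoid 0ℓ 0ℓ) (x₀ : DecSetoid.Carrier S)
         (all≈ : ∀ x y → DecSetoid._≈_ S x y) where
  open DecSetoid S using (_≈_)

  singletonEnumeration : WeightedEnumeration {n} S (λ _ → ⊤) (λ _ → 0ᵛ)
  singletonEnumeration = record
    { w-cong = λ _ → refl
    ; enum = λ e → if does (e ≟ᵛ 0ᵛ) then x₀ ∷ [] else []
    ; enumerates = λ e → record { sound = sound e ; unique = unique e ; complete = complete } }
    where
    sound : ∀ e → All (λ _ → ⊤ × 0ᵛ ≡ e) (if does (e ≟ᵛ 0ᵛ) then x₀ ∷ [] else [])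
    sound e with e ≟ᵛ 0ᵛ
    ... | yes e≡0 = (tt , sym e≡0) ∷ []
    ... | no _ = []
    unique : ∀ e → AllPairs (λ x y → ¬ x ≈ y) (if does (e ≟ᵛ 0ᵛ) then x₀ ∷ [] else [])
    unique e with e ≟ᵛ 0ᵛ
    ... | yes _ = [] ∷ []
    ... | no _ = []
    complete : ∀ {e x} → ⊤ × 0ᵛ ≡ e → Any (x ≈_) (if does (e ≟ᵛ 0ᵛ) then x₀ ∷ [] else [])
    complete {x = x} (_ , refl) with 0ᵛ {n} ≟ᵛ 0ᵛ
    ... | yes _ = here (all≈ x x₀)
    ... | no 0≢0 = ⊥-elim (0≢0 refl)

  series-singletonEnumeration : WeightedEnumeration.series singletonEnumeration ≗ onePS
  series-singletonEnumeration e with e ≟ᵛ 0ᵛ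
  ... | yes _ = refl
  ... | no _ = refl

unitEnumeration : ∀ {n} → WeightedEnumeration {n} (⊤.≡-decSetoid) (λ _ → ⊤) (λ _ → 0ᵛ)
unitEnumeration = singletonEnumeration ⊤.≡-decSetoid tt (λ _ _ → refl)

series-unitEnumeration : ∀ {n} → WeightedEnumeration.series (unitEnumeration {n}) ≗ onePS
series-unitEnumeration = series-singletonEnumeration ⊤.≡-decSetoid tt (λ _ _ → refl)

-- Every series counts something (the pairs (a , i) with i < A a, of weight a), so the laws of
-- ⊛ below follow from bijections between weighted sets.
canonicalEnumeration : ∀ {n} (A : PS n) →
  WeightedEnumeration (decSetoid (Product.≡-dec _≟ᵛ_ ℕ._≟_)) (λ (a , i) → i < A a) proj₁
canonicalEnumeration A = record
  { w-cong = cong proj₁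
  ; enum = λ e → map (e ,_) (upTo (A e))
  ; enumerates = λ e → record
    { sound = Allₚ.map⁺ (All.tabulate (λ i∈ → ∈-upTo⁻ i∈ , refl))
    ; unique = AllPairsₚ.map⁺ (AllPairs.map (λ i≢j eq → i≢j (cong proj₂ eq)) (upTo⁺ (A e)))
    ; complete = λ { (i< , refl) → Anyₚ.map⁺ (Any.map (cong (_ ,_)) (∈-upTo⁺ i<)) } } }

series-canonicalEnumeration : ∀ {n} (A : PS n) → WeightedEnumeration.series (canonicalEnumeration A) ≗ A
series-canonicalEnumeration A e = trans (length-map _ (upTo (A e))) (length-upTo (A e))

module _ {S₁ S₂ : DecSetoid 0ℓ 0ℓ} {P₁ : DecSetoid.Carrier S₁ → Set} {P₂ : DecSetoid.Carrier S₂ → Set} where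
  private
    module S₁ = DecSetoid S₁
    module S₂ = DecSetoid S₂

  ×-swap : Bijection (×-decSetoid S₁ S₂) (×-decSetoid S₂ S₁)
                     (λ (x , y) → P₁ x × P₂ y) (λ (y , x) → P₂ y × P₁ x)
  ×-swap = record
    { to = λ (x , y) → y , x ; from = λ (y , x) → x , y
    ; to-cong = λ (p , q) → q , p ; from-cong = λ (p , q) → q , p
    ; to-P = λ (p , q) → q , p ; from-P = λ (p , q) → q , p
    ; from∘to = λ _ → S₁.refl , S₂.refl ; to∘from = λ _ → S₂.refl , S₁.refl }

  module _ {S₃ : DecSetoid 0ℓ 0ℓ} {P₃ : DecSetoid.Carrier S₃ → Set} where
    private module S₃ = DecSetoid S₃

    ×-assoc : Bijection (×-decSetoid (×-decSetoid S₁ S₂) S₃) (×-decSetoid S₁ (×-decSetoid S₂ S₃))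
                        (λ ((x , y) , z) → (P₁ x × P₂ y) × P₃ z) (λ (x , (y , z)) → P₁ x × (P₂ y × P₃ z))
    ×-assoc = record
      { to = λ ((x , y) , z) → x , (y , z) ; from = λ (x , (y , z)) → (x , y) , z
      ; to-cong = λ ((p , q) , r) → p , (q , r) ; from-cong = λ (p , (q , r)) → (p , q) , r
      ; to-P = λ ((p , q) , r) → p , (q , r) ; from-P = λ (p , (q , r)) → (p , q) , r
      ; from∘to = λ _ → (S₁.refl , S₂.refl) , S₃.refl ; to∘from = λ _ → S₁.refl , (S₂.refl , S₃.refl) }

module _ {S : DecSetoid 0ℓ 0ℓ} {P : DecSetoid.Carrier S → Set} where
  private module S = DecSetoid S

  unit-×-projection : Bijection (×-decSetoid (⊤.≡-decSetoid) S) S (λ (_ , x) → ⊤ × P x) P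
  unit-×-projection = record
    { to = proj₂ ; from = tt ,_
    ; to-cong = proj₂ ; from-cong = refl ,_
    ; to-P = proj₂ ; from-P = tt ,_
    ; from∘to = λ _ → refl , S.refl ; to∘from = λ _ → S.refl }

module _ {n : ℕ} where
  private
    Sᶜ : DecSetoid 0ℓ 0ℓ
    Sᶜ = decSetoid (Product.≡-dec (_≟ᵛ_ {n}) ℕ._≟_)
    ⟦_⟧ : (A : PS n) → WeightedEnumeration Sᶜ (λ (a , i) → i < A a) proj₁
    ⟦_⟧ = canonicalEnumeration
    open WeightedEnumeration using (series; w-cong)

  ⊛-cong : ∀ {A A′ B B′ : PS n} → A ≗ A′ → B ≗ B′ → A ⊛ B ≗ A′ ⊛ B′
  ⊛-cong A≗ B≗ e = ℕ-sum.∑-cong (splits e) (λ (a , b) → cong₂ _*_ (A≗ a) (B≗ b))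

  ⊛-congʳ : ∀ (A : PS n) {B B′ : PS n} → B ≗ B′ → A ⊛ B ≗ A ⊛ B′
  ⊛-congʳ A = ⊛-cong {A = A} (λ _ → refl)

  series-×ᵉ : ∀ {S₁ S₂ P₁ P₂ w₁ w₂}
              (E₁ : WeightedEnumeration {n} S₁ P₁ w₁) (E₂ : WeightedEnumeration S₂ P₂ w₂) →
              series (E₁ ×ᵉ E₂) ≗ series E₁ ⊛ series E₂
  series-×ᵉ E₁ E₂ = series-pairEnumeration E₁ E₂ (×-pairing E₁ E₂)

  private
    series-⟦⟧×ᵉ⟦⟧ : ∀ A B → series (⟦ A ⟧ ×ᵉ ⟦ B ⟧) ≗ A ⊛ B
    series-⟦⟧×ᵉ⟦⟧ A B e = trans (series-×ᵉ ⟦ A ⟧ ⟦ B ⟧ e)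
      (⊛-cong (series-canonicalEnumeration A) (series-canonicalEnumeration B) e)

  ⊛-comm : ∀ (A B : PS n) → A ⊛ B ≗ B ⊛ A
  ⊛-comm A B e = begin
    (A ⊛ B) e                       ≡⟨ sym (series-⟦⟧×ᵉ⟦⟧ A B e) ⟩
    series (⟦ A ⟧ ×ᵉ ⟦ B ⟧) e
      ≡⟨ series-≗ (w-cong (⟦ B ⟧ ×ᵉ ⟦ A ⟧)) (×-swap {S₁ = Sᶜ} {S₂ = Sᶜ}) (λ _ → +ᵛ.comm _ _)
                  (⟦ A ⟧ ×ᵉ ⟦ B ⟧) (⟦ B ⟧ ×ᵉ ⟦ A ⟧) e ⟩
    series (⟦ B ⟧ ×ᵉ ⟦ A ⟧) e        ≡⟨ series-⟦⟧×ᵉ⟦⟧ B A e ⟩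
    (B ⊛ A) e                       ∎
    where open ≡-Reasoning

  ⊛-identityˡ : ∀ (A : PS n) → onePS ⊛ A ≗ A
  ⊛-identityˡ A e = begin
    (onePS ⊛ A) e                         ≡⟨ ⊛-cong (λ a → sym (series-unitEnumeration a))
                                                   (λ a → sym (series-canonicalEnumeration A a)) e ⟩
    (series unitEnumeration ⊛ series ⟦ A ⟧) e ≡⟨ sym (series-×ᵉ unitEnumeration ⟦ A ⟧ e) ⟩
    series (unitEnumeration ×ᵉ ⟦ A ⟧) e
      ≡⟨ series-≗ (w-cong ⟦ A ⟧) (unit-×-projection {S = Sᶜ}) (λ _ → sym (+ᵛ.identityˡ _))
                  (unitEnumeration ×ᵉ ⟦ A ⟧) ⟦ A ⟧ e ⟩
    series ⟦ A ⟧ e                         ≡⟨ series-canonicalEnumeration A e ⟩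
    A e                                   ∎
    where open ≡-Reasoning

  ⊛-assoc : ∀ (A B C : PS n) → (A ⊛ B) ⊛ C ≗ A ⊛ (B ⊛ C)
  ⊛-assoc A B C e = begin
    ((A ⊛ B) ⊛ C) e                      ≡⟨ ⊛-cong (λ a → sym (series-⟦⟧×ᵉ⟦⟧ A B a))
                                                  (λ a → sym (series-canonicalEnumeration C a)) e ⟩
    (series (⟦ A ⟧ ×ᵉ ⟦ B ⟧) ⊛ series ⟦ C ⟧) e
      ≡⟨ sym (series-×ᵉ (⟦ A ⟧ ×ᵉ ⟦ B ⟧) ⟦ C ⟧ e) ⟩
    series ((⟦ A ⟧ ×ᵉ ⟦ B ⟧) ×ᵉ ⟦ C ⟧) e
      ≡⟨ series-≗ (w-cong (⟦ A ⟧ ×ᵉ (⟦ B ⟧ ×ᵉ ⟦ C ⟧))) (×-assoc {S₁ = Sᶜ} {S₂ = Sᶜ} {S₃ = Sᶜ})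
                  (λ _ → sym (+ᵛ.assoc _ _ _))
                  ((⟦ A ⟧ ×ᵉ ⟦ B ⟧) ×ᵉ ⟦ C ⟧) (⟦ A ⟧ ×ᵉ (⟦ B ⟧ ×ᵉ ⟦ C ⟧)) e ⟩
    series (⟦ A ⟧ ×ᵉ (⟦ B ⟧ ×ᵉ ⟦ C ⟧)) e    ≡⟨ series-×ᵉ ⟦ A ⟧ (⟦ B ⟧ ×ᵉ ⟦ C ⟧) e ⟩
    (series ⟦ A ⟧ ⊛ series (⟦ B ⟧ ×ᵉ ⟦ C ⟧)) e
      ≡⟨ ⊛-cong (series-canonicalEnumeration A) (series-⟦⟧×ᵉ⟦⟧ B C) e ⟩
    (A ⊛ (B ⊛ C)) e                      ∎
    where open ≡-Reasoning

  x⊛yz≗y⊛xz : ∀ (A B C : PS n) → A ⊛ (B ⊛ C) ≗ B ⊛ (A ⊛ C)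
  x⊛yz≗y⊛xz A B C e = begin
    (A ⊛ (B ⊛ C)) e ≡⟨ sym (⊛-assoc A B C e) ⟩
    ((A ⊛ B) ⊛ C) e ≡⟨ ⊛-cong (⊛-comm A B) (λ _ → refl) e ⟩
    ((B ⊛ A) ⊛ C) e ≡⟨ ⊛-assoc B A C e ⟩
    (B ⊛ (A ⊛ C)) e ∎
    where open ≡-Reasoning

module _ {n : ℕ} {S : DecSetoid 0ℓ 0ℓ} {P : DecSetoid.Carrier S → Set} {w : DecSetoid.Carrier S → Vec ℕ n} where
  open DecSetoid S

  filterEnumeration : WeightedEnumeration S P w → {Q : Carrier → Set} → (Q? : ∀ t → Dec (Q t)) →
                      (∀ {t t′} → t ≈ t′ → Q t → Q t′) → WeightedEnumeration S (λ t → P t × Q t) w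
  filterEnumeration E Q? Q-resp = record
    { w-cong = E.w-cong
    ; enum = λ e → filter Q? (E.enum e)
    ; enumerates = λ e → enumerates-⇔ (enumerates-filter (E.enumerates e) Q? Q-resp)
                           (λ ((p , we) , q) → (p , q) , we) (λ ((p , q) , we) → (p , we) , q) }
    where module E = WeightedEnumeration E

Πˢ : ∀ {N} → (Fin N → DecSetoid 0ℓ 0ℓ) → DecSetoid 0ℓ 0ℓ
Πˢ {N} S = record
  { Carrier = (v : Fin N) → DecSetoid.Carrier (S v)
  ; _≈_ = λ d d′ → ∀ v → DecSetoid._≈_ (S v) (d v) (d′ v)
  ; isDecEquivalence = record
    { isEquivalence = record
      { refl = λ v → DecSetoid.refl (S v)
      ; sym = λ d≈ v → DecSetoid.sym (S v) (d≈ v)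
      ; trans = λ d≈ d≈′ v → DecSetoid.trans (S v) (d≈ v) (d≈′ v) }
    ; _≟_ = λ d d′ → all? (λ v → DecSetoid._≟_ (S v) (d v) (d′ v)) } }

scale-suc : ∀ {n} k (a : Vec ℕ n) → Vec.map (suc k *_) a ≡ a +ᵛ Vec.map (k *_) a
scale-suc k [] = refl
scale-suc k (x ∷ a) = cong (_ ∷_) (scale-suc k a)

scale-suc-injective : ∀ {n} k (a a′ : Vec ℕ n) → Vec.map (suc k *_) a ≡ Vec.map (suc k *_) a′ → a ≡ a′
scale-suc-injective k [] [] eq = refl
scale-suc-injective k (x ∷ a) (y ∷ a′) eq =
  cong₂ _∷_ (ℕ.*-cancelˡ-≡ x y (suc k) (cong Vec.head eq)) (scale-suc-injective k a a′ (cong Vec.tail eq))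

length-if : ∀ {A : Set} (b : Bool) (xs : List A) → length (if b then xs else []) ≡ (if b then length xs else 0)
length-if true xs = refl
length-if false xs = refl

module Figures {n : ℕ} (F : FigureSet n) where
  open WeightedEnumeration using (series)
  open ℕ-sum using ([_]·_; []·-yes; []·-no)

  f : PS n
  f = figSeries F

  Yˢ : DecSetoid 0ℓ 0ℓ
  Yˢ = decSetoid (_≟Y_ F)

  private
    fiber-sound-All : ∀ a → All (λ y → wt F y ≡ a) (fiber F a)
    fiber-sound-All a = All.tabulate (fiber-sound F a _)

  figureEnumeration : WeightedEnumeration Yˢ (λ _ → ⊤) (wt F)
  figureEnumeration = record
    { w-cong = cong (wt F)
    ; enum = fiber F
    ; enumerates = λ e → record
      { sound = All.map (tt ,_) (fiber-sound-All e)
      ; unique = fiber-unique F e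
      ; complete = λ { (_ , refl) → fiber-complete F _ } } }

  dilatedWeight : ℕ → Y F → Vec ℕ n
  dilatedWeight k y = Vec.map (suc k *_) (wt F y)

  module _ (k : ℕ) where
    private
      block : Vec ℕ n → Vec ℕ n × Vec ℕ n → List (Y F)
      block e (a , b) = if does (Vec.map (suc k *_) a ≟ᵛ e) then fiber F a else []

      block-sound : ∀ e ab → All (λ y → ⊤ × dilatedWeight k y ≡ e) (block e ab)
      block-sound e (a , b) with Vec.map (suc k *_) a ≟ᵛ e
      ... | yes ka≡e = All.map (λ wy → tt , trans (cong (Vec.map _) wy) ka≡e) (fiber-sound-All a)
      ... | no _ = []

      block-complete : ∀ y → Any (y ≡_) (block (dilatedWeight k y) (wt F y , Vec.map (k *_) (wt F y)))
      block-complete y with dilatedWeight k y ≟ᵛ dilatedWeight k y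
      ... | yes _ = fiber-complete F y
      ... | no ≢ = ⊥-elim (≢ refl)

      complete : ∀ y → Any (y ≡_) (concatMap (block (dilatedWeight k y)) (splits (dilatedWeight k y)))
      complete y = Anyₚ.concatMap⁺ _ (Any.map (λ { refl → block-complete y })
        (subst (λ e → Any (_≡ (wt F y , Vec.map (k *_) (wt F y))) (splits e))
          (sym (scale-suc k (wt F y))) (splits-complete (wt F y) (Vec.map (k *_) (wt F y)))))

      unique : ∀ e → AllPairs (λ y y′ → ¬ y ≡ y′) (concatMap (block e) (splits e))
      unique e = concatMap-AllPairs _ (AllPairs.map (λ {ab} {ab′} → across ab ab′) (splits-unique e))
                   (All.universal within (splits e))
        where
        across : ∀ ab ab′ → proj₁ ab ≢ proj₁ ab′ →
                 All (λ y → All (λ y′ → ¬ y ≡ y′) (block e ab′)) (block e ab)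
        across (a , _) (a′ , _) a≢a′ with Vec.map (suc k *_) a ≟ᵛ e | Vec.map (suc k *_) a′ ≟ᵛ e
        ... | yes ka≡e | yes ka′≡e = ⊥-elim (a≢a′ (scale-suc-injective k a a′ (trans ka≡e (sym ka′≡e))))
        ... | yes _ | no _ = All.universal (λ _ → []) _
        ... | no _ | _ = []
        within : ∀ ab → AllPairs (λ y y′ → ¬ y ≡ y′) (block e ab)
        within (a , _) with Vec.map (suc k *_) a ≟ᵛ e
        ... | yes _ = fiber-unique F a
        ... | no _ = []

    dilatedEnumeration : WeightedEnumeration Yˢ (λ _ → ⊤) (dilatedWeight k)
    dilatedEnumeration = record
      { w-cong = cong (dilatedWeight k)
      ; enum = λ e → concatMap (block e) (splits e)
      ; enumerates = λ e → record
        { sound = Allₚ.concat⁺ (Allₚ.map⁺ (All.universal (block-sound e) (splits e)))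
        ; unique = unique e
        ; complete = λ { {y} (_ , refl) → complete y } } }

    series-dilatedEnumeration : series dilatedEnumeration ≗ dilate (suc k) f
    series-dilatedEnumeration e = trans (ℕ-sum.length-concatMap (block e) (splits e))
      (ℕ-sum.∑-cong (splits e) (λ (a , _) → length-if _ (fiber F a)))

  Coloringˢ : ℕ → DecSetoid 0ℓ 0ℓ
  Coloringˢ = Pointwise.decSetoid Yˢ

  W-cong : ∀ {N} {c c′ : Fin N → Y F} → (∀ v → c v ≡ c′ v) → W F c ≡ W F c′
  W-cong {zero} c≗c′ = refl
  W-cong {suc N} c≗c′ = cong₂ _+ᵛ_ (cong (wt F) (c≗c′ zero)) (W-cong (c≗c′ ∘ suc))

  W-as-sum : ∀ {M} (c : Fin M → Y F) → W F c ≡ +ᵛ-sum.∑ (allFin M) (wt F ∘ c)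
  W-as-sum {zero} c = refl
  W-as-sum {suc M} c = trans (cong (wt F (c zero) +ᵛ_) (W-as-sum (c ∘ suc))) (sym (+ᵛ-sum.∑-allFin-suc (wt F ∘ c)))

  cons-pairing : ∀ k → Pairing {S₁ = Yˢ} {Coloringˢ k} {Coloringˢ (suc k)}
                               (λ _ → ⊤) (wt F) (λ _ → ⊤) (W F) (λ _ → ⊤) (W F)
  cons-pairing k = record
    { pair = VF._∷_ ; fst = VF.head ; snd = VF.tail ; w-cong = W-cong
    ; pair-cong = λ { y≡ c≗ zero → y≡ ; y≡ c≗ (suc v) → c≗ v }
    ; pair-injective = λ c≗ → c≗ zero , c≗ ∘ suc
    ; pair-P = λ _ _ → tt ; pair-w = λ _ _ → refl ; split-P = λ _ → tt , tt
    ; split-≈ = λ { _ zero → refl ; _ (suc v) → refl } }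

  private
    byPairing : ∀ k → WeightedEnumeration (Coloringˢ k) (λ _ → ⊤) (W F)
    byPairing zero = singletonEnumeration (Coloringˢ 0) (λ ()) (λ _ _ ())
    byPairing (suc k) = pairEnumeration figureEnumeration (byPairing k) (cons-pairing k)

    enum-byPairing : ∀ k → WeightedEnumeration.enum (byPairing k) ≗ colorings F k
    enum-byPairing zero e = refl
    enum-byPairing (suc k) = pairs-congʳ VF._∷_ (fiber F) (enum-byPairing k)

  coloringEnumeration : ∀ k → WeightedEnumeration (Coloringˢ k) (λ _ → ⊤) (W F)
  coloringEnumeration k = record
    { w-cong = W-cong
    ; enum = colorings F k
    ; enumerates = λ e → subst (Enumerates (Coloringˢ k) _) (enum-byPairing k e)
                               (WeightedEnumeration.enumerates (byPairing k) e) }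

  Factorˢ : Bool → DecSetoid 0ℓ 0ℓ
  Factorˢ b = if b then Yˢ else ⊤.≡-decSetoid

  factorWeight : (b : Bool) → ℕ → DecSetoid.Carrier (Factorˢ b) → Vec ℕ n
  factorWeight true k = dilatedWeight k
  factorWeight false k _ = 0ᵛ

  factor : Bool → ℕ → PS n
  factor b k = if b then dilate (suc k) f else onePS

  factorEnumeration : ∀ b k → WeightedEnumeration (Factorˢ b) (λ _ → ⊤) (factorWeight b k)
  factorEnumeration true k = dilatedEnumeration k
  factorEnumeration false k = unitEnumeration

  series-factorEnumeration : ∀ b k → series (factorEnumeration b k) ≗ factor b k
  series-factorEnumeration true k = series-dilatedEnumeration k
  series-factorEnumeration false k = series-unitEnumeration

  embed : (b : Bool) → Y F → DecSetoid.Carrier (Factorˢ b)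
  embed true y = y
  embed false _ = tt

  extract : (b : Bool) → T b → DecSetoid.Carrier (Factorˢ b) → Y F
  extract true _ y = y

  extract-embed : ∀ b (p : T b) y → extract b p (embed b y) ≡ y
  extract-embed true _ y = refl

  embed-extract : ∀ b (p : T b) x → DecSetoid._≈_ (Factorˢ b) (embed b (extract b p x)) x
  embed-extract true _ x = refl

  extract-cong : ∀ b (p : T b) {x y} → DecSetoid._≈_ (Factorˢ b) x y → extract b p x ≡ extract b p y
  extract-cong true _ x≡y = x≡y

  extract-irrelevant : ∀ b (p q : T b) x → extract b p x ≡ extract b q x
  extract-irrelevant true _ _ x = refl

  Factor-≈ : ∀ b {x y} → (T b → DecSetoid._≈_ (Factorˢ b) x y) → DecSetoid._≈_ (Factorˢ b) x y
  Factor-≈ true x≈y = x≈y tt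
  Factor-≈ false _ = refl

  factorWeight-embed : ∀ {P : Set} (P? : Dec P) k y →
                        factorWeight (does P?) k (embed (does P?) y) ≡ +ᵛ-sum.[ P? ]· dilatedWeight k y
  factorWeight-embed (yes _) k y = refl
  factorWeight-embed (no _) k y = refl

  -- Colorings of the vertices selected by R (a dummy value elsewhere); in restrictedWeight the
  -- color of v counts ℓ v + 1 times, matching the factor f(w^(ℓ v + 1)).
  Restrictedˢ : ∀ {N} → (Fin N → Bool) → DecSetoid 0ℓ 0ℓ
  Restrictedˢ R = Πˢ (Factorˢ ∘ R)

  restrictedWeight : ∀ {N} (R : Fin N → Bool) (ℓ : Fin N → ℕ) → DecSetoid.Carrier (Restrictedˢ R) → Vec ℕ n
  restrictedWeight {zero} R ℓ d = 0ᵛ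
  restrictedWeight {suc N} R ℓ d =
    factorWeight (R zero) (ℓ zero) (d zero) +ᵛ restrictedWeight (R ∘ suc) (ℓ ∘ suc) (d ∘ suc)

  restrictedWeight-as-sum : ∀ {M} (R : Fin M → Bool) (ℓ : Fin M → ℕ) d →
    restrictedWeight R ℓ d ≡ +ᵛ-sum.∑ (allFin M) (λ v → factorWeight (R v) (ℓ v) (d v))
  restrictedWeight-as-sum {zero} R ℓ d = refl
  restrictedWeight-as-sum {suc M} R ℓ d =
    trans (cong (factorWeight (R zero) (ℓ zero) (d zero) +ᵛ_) (restrictedWeight-as-sum (R ∘ suc) (ℓ ∘ suc) (d ∘ suc)))
          (sym (+ᵛ-sum.∑-allFin-suc (λ v → factorWeight (R v) (ℓ v) (d v))))

  ∏factors : ∀ {N} → (Fin N → Bool) → (Fin N → ℕ) → PS n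
  ∏factors {zero} R ℓ = onePS
  ∏factors {suc N} R ℓ = factor (R zero) (ℓ zero) ⊛ ∏factors (R ∘ suc) (ℓ ∘ suc)

  private
    factorWeight-cong : ∀ b k {x y} → DecSetoid._≈_ (Factorˢ b) x y → factorWeight b k x ≡ factorWeight b k y
    factorWeight-cong true k = cong (dilatedWeight k)
    factorWeight-cong false k _ = refl

    restrictedWeight-cong : ∀ {N} (R : Fin N → Bool) ℓ {d d′} → DecSetoid._≈_ (Restrictedˢ R) d d′ →
                            restrictedWeight R ℓ d ≡ restrictedWeight R ℓ d′
    restrictedWeight-cong {zero} R ℓ _ = refl
    restrictedWeight-cong {suc N} R ℓ d≈ = cong₂ _+ᵛ_ (factorWeight-cong (R zero) (ℓ zero) (d≈ zero))
      (restrictedWeight-cong (R ∘ suc) (ℓ ∘ suc) (d≈ ∘ suc))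

    restricted-cons : ∀ {N} (R : Fin (suc N) → Bool) (ℓ : Fin (suc N) → ℕ) →
      Pairing {S₁ = Factorˢ (R zero)} {Restrictedˢ (R ∘ suc)} {Restrictedˢ R}
              (λ _ → ⊤) (factorWeight (R zero) (ℓ zero)) (λ _ → ⊤) (restrictedWeight (R ∘ suc) (ℓ ∘ suc))
              (λ _ → ⊤) (restrictedWeight R ℓ)
    restricted-cons R ℓ = record
      { pair = λ { x d zero → x ; x d (suc v) → d v } ; fst = λ d → d zero ; snd = λ d → d ∘ suc
      ; w-cong = restrictedWeight-cong R ℓ
      ; pair-cong = λ { x≈ d≈ zero → x≈ ; x≈ d≈ (suc v) → d≈ v }
      ; pair-injective = λ d≈ → d≈ zero , d≈ ∘ suc
      ; pair-P = λ _ _ → tt ; pair-w = λ _ _ → refl ; split-P = λ _ → tt , tt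
      ; split-≈ = λ { _ zero → DecSetoid.refl (Factorˢ (R zero)) ; _ (suc v) → DecSetoid.refl (Factorˢ (R (suc v))) } }

  restrictedEnumeration : ∀ {N} (R : Fin N → Bool) ℓ →
                          WeightedEnumeration (Restrictedˢ R) (λ _ → ⊤) (restrictedWeight R ℓ)
  restrictedEnumeration {zero} R ℓ = singletonEnumeration (Restrictedˢ R) (λ ()) (λ _ _ ())
  restrictedEnumeration {suc N} R ℓ =
    pairEnumeration (factorEnumeration (R zero) (ℓ zero)) (restrictedEnumeration (R ∘ suc) (ℓ ∘ suc))
                    (restricted-cons R ℓ)

  series-restrictedEnumeration : ∀ {N} (R : Fin N → Bool) ℓ → series (restrictedEnumeration R ℓ) ≗ ∏factors R ℓ
  series-restrictedEnumeration {zero} R ℓ = series-singletonEnumeration (Restrictedˢ R) (λ ()) (λ _ _ ())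
  series-restrictedEnumeration {suc N} R ℓ e = trans
    (series-pairEnumeration (factorEnumeration (R zero) (ℓ zero)) (restrictedEnumeration (R ∘ suc) (ℓ ∘ suc))
                            (restricted-cons R ℓ) e)
    (⊛-cong (series-factorEnumeration (R zero) (ℓ zero)) (series-restrictedEnumeration (R ∘ suc) (ℓ ∘ suc)) e)

  ∏dilations : List ℕ → (ℕ → ℕ) → PS n
  ∏dilations I m = foldr (λ i acc → (dilate (suc i) f ^ᵖ m i) ⊛ acc) onePS I

  multiplicity : ∀ {N} → (Fin N → Bool) → (Fin N → ℕ) → ℕ → ℕ
  multiplicity {N} R ℓ i = ℕ-sum.∑ (allFin N) (λ v → if R v then [ ℓ v ≟ i ]· 1 else 0)

  ∏dilations-cong : ∀ I {m m′ : ℕ → ℕ} → All (λ i → m i ≡ m′ i) I → ∏dilations I m ≡ ∏dilations I m′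
  ∏dilations-cong [] [] = refl
  ∏dilations-cong (i ∷ I) (m≡ ∷ ms≡) =
    cong₂ (λ a q → (dilate (suc i) f ^ᵖ a) ⊛ q) m≡ (∏dilations-cong I ms≡)

  private
    ∏dilations-zero : ∀ I → ∏dilations I (λ _ → 0) ≗ onePS
    ∏dilations-zero [] e = refl
    ∏dilations-zero (i ∷ I) e = trans (⊛-identityˡ _ e) (∏dilations-zero I e)

    bump : ℕ → (ℕ → ℕ) → ℕ → ℕ
    bump k m i = [ k ≟ i ]· 1 + m i

    ∏dilations-bump : ∀ {I} k m → AllPairs _≢_ I → Any (k ≡_) I →
                      ∏dilations I (bump k m) ≗ dilate (suc k) f ⊛ ∏dilations I m
    ∏dilations-bump {i ∷ I} k m (i∉I ∷ unique) k∈ e with k ≟ i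
    ... | yes refl = begin
        ((A ⊛ (A ^ᵖ m k)) ⊛ ∏dilations I (bump k m)) e
      ≡⟨ cong (λ q → ((A ⊛ (A ^ᵖ m k)) ⊛ q) e)
           (∏dilations-cong I (All.map (λ k≢j → cong (_+ m _) ([]·-no (k ≟ _) 1 k≢j)) i∉I)) ⟩
        ((A ⊛ (A ^ᵖ m k)) ⊛ ∏dilations I m) e
      ≡⟨ ⊛-assoc A (A ^ᵖ m k) (∏dilations I m) e ⟩
        (A ⊛ ((A ^ᵖ m k) ⊛ ∏dilations I m)) e
      ∎
      where
      open ≡-Reasoning
      A : PS n
      A = dilate (suc k) f
    ... | no k≢i with k∈
    ...   | here k≡i = ⊥-elim (k≢i k≡i)
    ...   | there k∈I = begin
        ((Aᵢ ^ᵖ m i) ⊛ ∏dilations I (bump k m)) e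
      ≡⟨ ⊛-congʳ (Aᵢ ^ᵖ m i) (∏dilations-bump k m unique k∈I) e ⟩
        ((Aᵢ ^ᵖ m i) ⊛ (dilate (suc k) f ⊛ ∏dilations I m)) e
      ≡⟨ x⊛yz≗y⊛xz (Aᵢ ^ᵖ m i) (dilate (suc k) f) (∏dilations I m) e ⟩
        (dilate (suc k) f ⊛ ((Aᵢ ^ᵖ m i) ⊛ ∏dilations I m)) e
      ∎
      where
      open ≡-Reasoning
      Aᵢ : PS n
      Aᵢ = dilate (suc i) f

    factor-⊛-∏dilations : ∀ K b k m → (T b → k < K) →
      factor b k ⊛ ∏dilations (upTo K) m ≗ ∏dilations (upTo K) (λ i → (if b then [ k ≟ i ]· 1 else 0) + m i)
    factor-⊛-∏dilations K true k m k<K e = sym (∏dilations-bump k m (upTo⁺ K) (∈-upTo⁺ (k<K tt)) e)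
    factor-⊛-∏dilations K false k m _ e = ⊛-identityˡ _ e

  ∏factors-regroup : ∀ K {N} (R : Fin N → Bool) ℓ → (∀ v → T (R v) → ℓ v < K) →
                     ∏factors R ℓ ≗ ∏dilations (upTo K) (multiplicity R ℓ)
  ∏factors-regroup K {zero} R ℓ _ e = sym (∏dilations-zero (upTo K) e)
  ∏factors-regroup K {suc N} R ℓ ℓ<K e = begin
      (factor (R zero) (ℓ zero) ⊛ ∏factors (R ∘ suc) (ℓ ∘ suc)) e
    ≡⟨ ⊛-congʳ (factor (R zero) (ℓ zero)) (∏factors-regroup K (R ∘ suc) (ℓ ∘ suc) (ℓ<K ∘ suc)) e ⟩
      (factor (R zero) (ℓ zero) ⊛ ∏dilations (upTo K) (multiplicity (R ∘ suc) (ℓ ∘ suc))) e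
    ≡⟨ factor-⊛-∏dilations K (R zero) (ℓ zero) _ (ℓ<K zero) e ⟩
      ∏dilations (upTo K) (λ i → (if R zero then [ ℓ zero ≟ i ]· 1 else 0) + multiplicity (R ∘ suc) (ℓ ∘ suc) i) e
    ≡⟨ cong (λ q → q e) (∏dilations-cong (upTo K) (All.universal (λ i →
         sym (ℕ-sum.∑-allFin-suc (λ v → if R v then [ ℓ v ≟ i ]· 1 else 0))) _)) ⟩
      ∏dilations (upTo K) (multiplicity R ℓ) e
    ∎
    where open ≡-Reasoning

first : ∀ {N} → (Fin N → Bool) → Maybe (Fin N)
first {zero} p = nothing
first {suc N} p = if p zero then just zero else Maybe.map suc (first (p ∘ suc))

first-cong : ∀ {N} {p q : Fin N → Bool} → p ≗ q → first p ≡ first q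
first-cong {zero} p≗q = refl
first-cong {suc N} {p} {q} p≗q
  rewrite p≗q zero | first-cong {p = p ∘ suc} {q ∘ suc} (p≗q ∘ suc) = refl

first-sound : ∀ {N} (p : Fin N → Bool) {i} → p i ≡ true → ∃ λ k → first p ≡ just k × p k ≡ true
first-sound {suc N} p {i} pi with p zero in p0
... | true = zero , refl , p0
first-sound {suc N} p {zero} pi | false = ⊥-elim (false≢true (trans (sym p0) pi))
  where
  false≢true : false ≢ true
  false≢true ()
first-sound {suc N} p {suc i} pi | false with first-sound (p ∘ suc) pi
... | k , first≡ , pk rewrite first≡ = suc k , refl , pk

firstOr : ∀ {N} → (Fin N → Bool) → Fin N → Fin N
firstOr p d = maybe id d (first p)

firstOr-sound : ∀ {N} (p : Fin N → Bool) d {i} → p i ≡ true → p (firstOr p d) ≡ true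
firstOr-sound p d pi with first-sound p pi
... | k , first≡ , pk rewrite first≡ = pk

firstOr-cong : ∀ {N} {p q : Fin N → Bool} d d′ {i} → p ≗ q → p i ≡ true → firstOr p d ≡ firstOr q d′
firstOr-cong {p = p} {q} d d′ p≗q pi with first-sound p pi
... | k , first≡ , _ rewrite sym (first-cong p≗q) | first≡ = refl

does-sound : ∀ {P : Set} (P? : Dec P) → does P? ≡ true → P
does-sound (yes p) _ = p

does-⇔ : ∀ {P Q : Set} (P? : Dec P) (Q? : Dec Q) → (P → Q) → (Q → P) → does P? ≡ does Q?
does-⇔ (yes p) (yes q) f g = refl
does-⇔ (yes p) (no ¬q) f g = ⊥-elim (¬q (f p))
does-⇔ (no ¬p) (yes q) f g = ⊥-elim (¬p (g q))
does-⇔ (no ¬p) (no ¬q) f g = refl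

iter-+ : ∀ {A : Set} (g : A → A) a b x → iter g (a + b) x ≡ iter g a (iter g b x)
iter-+ g zero b x = refl
iter-+ g (suc a) b x = cong g (iter-+ g a b x)

iter-comm : ∀ {A : Set} (g : A → A) a b x → iter g a (iter g b x) ≡ iter g b (iter g a x)
iter-comm g a b x = trans (sym (iter-+ g a b x)) (trans (cong (λ k → iter g k x) (ℕ.+-comm a b)) (iter-+ g b a x))

iter-cong : ∀ {A : Set} {g h : A → A} → g ≗ h → ∀ k x → iter g k x ≡ iter h k x
iter-cong g≗h zero x = refl
iter-cong {g = g} g≗h (suc k) x = trans (cong g (iter-cong g≗h k x)) (g≗h _)

module Cycles {N : ℕ} (γ : Fin N → Fin N) (γ-injective : ∀ u v → γ u ≡ γ v → u ≡ v) where

  iter-injective : ∀ k {x y} → iter γ k x ≡ iter γ k y → x ≡ y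
  iter-injective zero eq = eq
  iter-injective (suc k) eq = iter-injective k (γ-injective _ _ eq)

  private
    period : ∀ v → ∃ λ p → 0 < p × p ≤ N × iter γ p v ≡ v
    period v with pigeonhole (ℕ.n<1+n N) (λ (j : Fin (suc N)) → iter γ (toℕ j) v)
    ... | i , j , i<j , eq = toℕ j ∸ toℕ i , ℕ.m<n⇒0<n∸m i<j ,
      ℕ.≤-trans (ℕ.m∸n≤m (toℕ j) (toℕ i)) (ℕ.≤-pred (toℕ<n j)) ,
      sym (iter-injective (toℕ i) (trans eq (trans (cong (λ k → iter γ k v) (sym (ℕ.m+[n∸m]≡n (ℕ.<⇒≤ i<j))))
        (iter-+ γ (toℕ i) (toℕ j ∸ toℕ i) v))))

    cycle : ∀ v → ∃ λ i → OnCycle γ i v × i < N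
    cycle v with ¬∀⟶∃¬-smallest N (λ i → ¬ iter γ (suc (toℕ i)) v ≡ v)
                   (λ i → ¬? (iter γ (suc (toℕ i)) v ≟ᶠ v)) returns-v
      where
      returns-v : ¬ (∀ (i : Fin N) → ¬ iter γ (suc (toℕ i)) v ≡ v)
      returns-v never with period v
      ... | suc p , _ , p<N , eq = never (fromℕ< p<N) (subst (λ k → iter γ (suc k) v ≡ v) (sym (toℕ-fromℕ< p<N)) eq)
    ... | i , ¬¬returns , earlier = toℕ i ,
      (decidable-stable (iter γ (suc (toℕ i)) v ≟ᶠ v) ¬¬returns ,
       λ m → subst (λ k → ¬ iter γ (suc k) v ≡ v) (toℕ-inject m) (earlier m)) ,
      toℕ<n i

  lenPred : Fin N → ℕ
  lenPred v = proj₁ (cycle v)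

  len : Fin N → ℕ
  len v = suc (lenPred v)

  lenPred<N : ∀ v → lenPred v < N
  lenPred<N v = proj₂ (proj₂ (cycle v))

  onCycle : ∀ v → OnCycle γ (lenPred v) v
  onCycle v = proj₁ (proj₂ (cycle v))

  onCycle-unique : ∀ {i j v} → OnCycle γ i v → OnCycle γ j v → i ≡ j
  onCycle-unique {i} {j} {v} (ri , mi) (rj , mj) with ℕ.<-cmp i j
  ... | tri< i<j _ _ = ⊥-elim (mj (fromℕ< i<j) (subst (λ k → iter γ (suc k) v ≡ v) (sym (toℕ-fromℕ< i<j)) ri))
  ... | tri≈ _ i≡j _ = i≡j
  ... | tri> _ _ j<i = ⊥-elim (mi (fromℕ< j<i) (subst (λ k → iter γ (suc k) v ≡ v) (sym (toℕ-fromℕ< j<i)) rj))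

  lenPred-onCycle : ∀ {i v} → OnCycle γ i v → lenPred v ≡ i
  lenPred-onCycle = onCycle-unique (onCycle _)

  iter-len : ∀ v → iter γ (len v) v ≡ v
  iter-len v = proj₁ (onCycle v)

  iter-reduce : ∀ v j → ∃ λ r → r < len v × iter γ j v ≡ iter γ r v
  iter-reduce v zero = 0 , s≤s z≤n , refl
  iter-reduce v (suc j) with iter-reduce v j
  ... | r , r<len , eq with ℕ.m≤n⇒m<n∨m≡n r<len
  ...   | inj₁ r+1<len = suc r , r+1<len , cong γ eq
  ...   | inj₂ r+1≡len = 0 , s≤s z≤n , trans (cong γ eq) (trans (cong (λ k → iter γ k v) r+1≡len) (iter-len v))

  private
    no-early-return : ∀ v k → 0 < k → k < len v → iter γ k v ≢ v
    no-early-return v (suc d) _ k<len = proj₂ (onCycle v) (fromℕ< d<)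
      ∘ subst (λ k → iter γ (suc k) v ≡ v) (sym (toℕ-fromℕ< d<))
      where
      d< : d < lenPred v
      d< = ℕ.≤-pred k<len

    iter-distinct< : ∀ v {a b} → a < b → b < len v → iter γ a v ≢ iter γ b v
    iter-distinct< v {a} {b} a<b b<len eq = no-early-return v (b ∸ a) (ℕ.m<n⇒0<n∸m a<b)
      (ℕ.≤-<-trans (ℕ.m∸n≤m b a) b<len) (iter-injective a (begin
        iter γ a (iter γ (b ∸ a) v) ≡⟨ sym (iter-+ γ a (b ∸ a) v) ⟩
        iter γ (a + (b ∸ a)) v      ≡⟨ cong (λ k → iter γ k v) (ℕ.m+[n∸m]≡n (ℕ.<⇒≤ a<b)) ⟩
        iter γ b v                  ≡⟨ sym eq ⟩
        iter γ a v                  ∎))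
      where open ≡-Reasoning

  iter-distinct : ∀ v {a b} → a < len v → b < len v → iter γ a v ≡ iter γ b v → a ≡ b
  iter-distinct v {a} {b} a<len b<len eq with ℕ.<-cmp a b
  ... | tri≈ _ a≡b _ = a≡b
  ... | tri< a<b _ _ = ⊥-elim (iter-distinct< v a<b b<len eq)
  ... | tri> _ _ b<a = ⊥-elim (iter-distinct< v b<a a<len (sym eq))

  infix 4 _~_
  _~_ : Fin N → Fin N → Set
  v ~ w = ∃ λ j → iter γ j v ≡ w

  private
    _~ᶠ_ : Fin N → Fin N → Set
    v ~ᶠ w = ∃ λ (j : Fin N) → iter γ (toℕ j) v ≡ w

    ~⇒~ᶠ : ∀ {v w} → v ~ w → v ~ᶠ w
    ~⇒~ᶠ {v} (j , eq) with iter-reduce v j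
    ... | r , r<len , eq′ = fromℕ< r<N , trans (cong (λ k → iter γ k v) (toℕ-fromℕ< r<N)) (trans (sym eq′) eq)
      where r<N = ℕ.≤-trans r<len (lenPred<N v)

  _~?_ : ∀ v w → Dec (v ~ w)
  v ~? w with any? (λ (j : Fin N) → iter γ (toℕ j) v ≟ᶠ w)
  ... | yes (j , eq) = yes (toℕ j , eq)
  ... | no ¬~ᶠ = no (¬~ᶠ ∘ ~⇒~ᶠ)

  ~-refl : ∀ {v} → v ~ v
  ~-refl = 0 , refl

  ~-trans : ∀ {u v w} → u ~ v → v ~ w → u ~ w
  ~-trans {u} (a , refl) (b , refl) = b + a , iter-+ γ b a u

  ~-sym : ∀ {v w} → v ~ w → w ~ v
  ~-sym {v} (j , refl) with iter-reduce v j
  ... | r , r<len , eq = len v ∸ r , (begin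
    iter γ (len v ∸ r) (iter γ j v) ≡⟨ cong (iter γ (len v ∸ r)) eq ⟩
    iter γ (len v ∸ r) (iter γ r v) ≡⟨ sym (iter-+ γ (len v ∸ r) r v) ⟩
    iter γ (len v ∸ r + r) v        ≡⟨ cong (λ k → iter γ k v) (ℕ.m∸n+n≡m (ℕ.<⇒≤ r<len)) ⟩
    iter γ (len v) v                ≡⟨ iter-len v ⟩
    v                               ∎)
    where open ≡-Reasoning

  onCycle-~ : ∀ {i v w} → v ~ w → OnCycle γ i v → OnCycle γ i w
  onCycle-~ {i} {v} (j , refl) (returns , minimal) =
    trans (iter-comm γ (suc i) j v) (cong (iter γ j) returns) ,
    λ m eq → minimal m (iter-injective j (trans (iter-comm γ j (suc (toℕ m)) v) eq))

  rep : Fin N → Fin N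
  rep v = firstOr (λ w → does (v ~? w)) v

  rep-~ : ∀ v → v ~ rep v
  rep-~ v = does-sound (v ~? rep v) (firstOr-sound (λ w → does (v ~? w)) v (dec-true (v ~? v) ~-refl))

  rep-cong : ∀ {v w} → v ~ w → rep v ≡ rep w
  rep-cong {v} {w} v~w = firstOr-cong v w
    (λ u → does-⇔ (v ~? u) (w ~? u) (~-trans (~-sym v~w)) (~-trans v~w))
    (dec-true (v ~? v) ~-refl)

  rep-idem : ∀ v → rep (rep v) ≡ rep v
  rep-idem v = rep-cong (~-sym (rep-~ v))

  rep-≡⇒~ : ∀ {v w} → rep v ≡ rep w → v ~ w
  rep-≡⇒~ {v} {w} eq = ~-trans (rep-~ v) (subst (_~ w) (sym eq) (~-sym (rep-~ w)))

  isRep : Fin N → Bool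
  isRep r = does (rep r ≟ᶠ r)

  module _ {c ℓ} (M : CommutativeMonoid c ℓ) where
    open CommutativeMonoid M using (_≈_; ε; reflexive)
      renaming (Carrier to C; sym to ≈-sym; trans to ≈-trans)
    open ListSum M

    ∑-allFin-[≟]· : ∀ a (F : Fin N → C) → ∑ (allFin N) (λ r → [ a ≟ᶠ r ]· F r) ≈ F a
    ∑-allFin-[≟]· a F = ∑-[]·-single (a ≟ᶠ_) F (All.universal (λ _ → tt) _) (allFin⁺ N)
      (λ _ _ x≢y a≡x a≡y → x≢y (trans (sym a≡x) a≡y)) (∈-allFin a) (λ _ a≡x → reflexive (cong F (sym a≡x)))

    ∑-by-cycles : ∀ (h : Fin N → C) → ∑ (allFin N) h ≈
      ∑ (allFin N) (λ r → [ rep r ≟ᶠ r ]· ∑ (allFin N) (λ v → [ rep v ≟ᶠ r ]· h v))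
    ∑-by-cycles h =
      ≈-trans (∑-cong (allFin N) (λ v → ≈-sym (∑-allFin-[≟]· (rep v) (λ _ → h v))))
        (≈-trans (∑-comm (allFin N) (allFin N) (λ v r → [ rep v ≟ᶠ r ]· h v))
          (∑-cong (allFin N) only-representatives))
      where
      only-representatives : ∀ r → ∑ (allFin N) (λ v → [ rep v ≟ᶠ r ]· h v) ≈
                                   [ rep r ≟ᶠ r ]· ∑ (allFin N) (λ v → [ rep v ≟ᶠ r ]· h v)
      only-representatives r with rep r ≟ᶠ r
      ... | yes _ = CommutativeMonoid.refl M
      ... | no rep≢r = ∑-[]·-none (λ v → rep v ≟ᶠ r) {allFin N} h
        (All.universal (λ v rep≡r → rep≢r (trans (cong rep (sym rep≡r)) (trans (rep-idem v) rep≡r))) _)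

  open ℕ-sum using (∑; [_]·_)

  cycle-size : ∀ r → rep r ≡ r → ∑ (allFin N) (λ v → [ rep v ≟ᶠ r ]· 1) ≡ len r
  cycle-size r rep≡r = begin
    ∑ (allFin N) (λ v → [ rep v ≟ᶠ r ]· 1)
      ≡⟨ ℕ-sum.∑-cong (allFin N) orbit-once ⟩
    ∑ (allFin N) (λ v → ∑ (upTo (len r)) (λ j → [ iter γ j r ≟ᶠ v ]· 1))
      ≡⟨ ℕ-sum.∑-comm (allFin N) (upTo (len r)) (λ v j → [ iter γ j r ≟ᶠ v ]· 1) ⟩
    ∑ (upTo (len r)) (λ j → ∑ (allFin N) (λ v → [ iter γ j r ≟ᶠ v ]· 1))
      ≡⟨ ℕ-sum.∑-cong (upTo (len r)) (λ j → ∑-allFin-[≟]· ℕ.+-0-commutativeMonoid (iter γ j r) (λ _ → 1)) ⟩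
    ∑ (upTo (len r)) (λ _ → 1)
      ≡⟨ ℕ-sum.∑-one (upTo (len r)) ⟩
    length (upTo (len r))
      ≡⟨ length-upTo (len r) ⟩
    len r ∎
    where
    open ≡-Reasoning
    orbit-once : ∀ v → [ rep v ≟ᶠ r ]· 1 ≡ ∑ (upTo (len r)) (λ j → [ iter γ j r ≟ᶠ v ]· 1)
    orbit-once v with rep v ≟ᶠ r
    ... | yes rep≡ = sym (ℕ-sum.∑-[]·-single (λ j → iter γ j r ≟ᶠ v) {upTo (len r)} (λ _ → 1)
      (All.tabulate ∈-upTo⁻) (upTo⁺ (len r))
      (λ a< b< a≢b a≡ b≡ → a≢b (iter-distinct r a< b< (trans a≡ (sym b≡)))) reached (λ _ _ → refl))
      where
      reached : Any (λ j → iter γ j r ≡ v) (upTo (len r))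
      reached with rep-≡⇒~ (trans rep≡r (sym rep≡))
      ... | j , refl with iter-reduce r j
      ...   | k , k<len , eq = Any.map (λ { refl → sym eq }) (∈-upTo⁺ k<len)
    ... | no rep≢ = sym (ℕ-sum.∑-[]·-none (λ j → iter γ j r ≟ᶠ v) {upTo (len r)} (λ _ → 1)
      (All.universal (λ j eq → rep≢ (trans (sym (rep-cong (j , eq))) rep≡r)) _))

  points-on-cycles : ∀ i → ∑ (allFin N) (λ v → [ OnCycle? γ i v ]· 1) ≡
                           suc i * ∑ (allFin N) (λ r → [ rep r ≟ᶠ r ]· [ OnCycle? γ i r ]· 1)
  points-on-cycles i = trans (∑-by-cycles ℕ.+-0-commutativeMonoid (λ v → [ OnCycle? γ i v ]· 1))
    (trans (ℕ-sum.∑-cong (allFin N) per-cycle) (ℕ-sum.∑-*ˡ (allFin N) (suc i) _))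
    where
    per-cycle : ∀ r → [ rep r ≟ᶠ r ]· ∑ (allFin N) (λ v → [ rep v ≟ᶠ r ]· [ OnCycle? γ i v ]· 1)
                      ≡ suc i * [ rep r ≟ᶠ r ]· [ OnCycle? γ i r ]· 1
    per-cycle r with rep r ≟ᶠ r
    ... | no _ = sym (ℕ.*-zeroʳ (suc i))
    ... | yes rep≡r = begin
        ∑ (allFin N) (λ v → [ rep v ≟ᶠ r ]· [ OnCycle? γ i v ]· 1)
      ≡⟨ ℕ-sum.∑-cong (allFin N) same-cycle ⟩
        ∑ (allFin N) (λ v → [ OnCycle? γ i r ]· 1 * [ rep v ≟ᶠ r ]· 1)
      ≡⟨ ℕ-sum.∑-*ˡ (allFin N) ([ OnCycle? γ i r ]· 1) (λ v → [ rep v ≟ᶠ r ]· 1) ⟩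
        [ OnCycle? γ i r ]· 1 * ∑ (allFin N) (λ v → [ rep v ≟ᶠ r ]· 1)
      ≡⟨ cong ([ OnCycle? γ i r ]· 1 *_) (cycle-size r rep≡r) ⟩
        [ OnCycle? γ i r ]· 1 * len r
      ≡⟨ length-is-i+1 ⟩
        suc i * [ OnCycle? γ i r ]· 1
      ∎
      where
      open ≡-Reasoning
      same-cycle : ∀ v → [ rep v ≟ᶠ r ]· [ OnCycle? γ i v ]· 1 ≡ [ OnCycle? γ i r ]· 1 * [ rep v ≟ᶠ r ]· 1
      same-cycle v with rep v ≟ᶠ r
      ... | no _ = sym (ℕ.*-zeroʳ ([ OnCycle? γ i r ]· 1))
      ... | yes rep≡ = trans (ℕ-sum.[]·-⇔ (OnCycle? γ i v) (OnCycle? γ i r) 1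
          (onCycle-~ (rep-≡⇒~ (trans rep≡ (sym rep≡r)))) (onCycle-~ (rep-≡⇒~ (trans rep≡r (sym rep≡)))))
        (sym (ℕ.*-identityʳ _))
      length-is-i+1 : [ OnCycle? γ i r ]· 1 * len r ≡ suc i * [ OnCycle? γ i r ]· 1
      length-is-i+1 with OnCycle? γ i r
      ... | yes on = trans (ℕ.+-identityʳ (len r)) (trans (cong suc (lenPred-onCycle on)) (sym (ℕ.*-identityʳ (suc i))))
      ... | no _ = sym (ℕ.*-zeroʳ (suc i))

∑-[]·-constᵛ : ∀ {n} {A : Set} (xs : List A) {Q : A → Set} (Q? : ∀ x → Dec (Q x)) (a : Vec ℕ n) →
               +ᵛ-sum.∑ xs (λ x → +ᵛ-sum.[ Q? x ]· a) ≡ Vec.map (ℕ-sum.∑ xs (λ x → ℕ-sum.[ Q? x ]· 1) *_) a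
∑-[]·-constᵛ [] Q? a = sym (zero-scaling a)
  where
  zero-scaling : ∀ {m} (a : Vec ℕ m) → Vec.map (0 *_) a ≡ 0ᵛ
  zero-scaling [] = refl
  zero-scaling (x ∷ a) = cong (0 ∷_) (zero-scaling a)
∑-[]·-constᵛ (x ∷ xs) Q? a with Q? x
... | yes _ = trans (cong (a +ᵛ_) (∑-[]·-constᵛ xs Q? a))
                    (sym (scale-suc (ℕ-sum.∑ xs (λ x → ℕ-sum.[ Q? x ]· 1)) a))
... | no _ = trans (+ᵛ.identityˡ _) (∑-[]·-constᵛ xs Q? a)

[]·-if : ∀ {P : Set} (P? : Dec P) (x : ℕ) → ℕ-sum.[ P? ]· x ≡ (if does P? then x else 0)
[]·-if (yes _) x = refl
[]·-if (no _) x = refl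

module Polya {n : ℕ} (F : FigureSet n) {N : ℕ} (γ : Fin N → Fin N)
             (γ-injective : ∀ u v → γ u ≡ γ v → u ≡ v) where
  open Figures F
  open Cycles γ γ-injective
  open WeightedEnumeration using (series)

  Fixed : (Fin N → Y F) → Set
  Fixed c = ∀ u → c (γ u) ≡ c u

  fixed? : ∀ c → Dec (Fixed c)
  fixed? c = all? (λ u → _≟Y_ F (c (γ u)) (c u))

  fixedColoringEnumeration : WeightedEnumeration (Coloringˢ N) (λ c → ⊤ × Fixed c) (W F)
  fixedColoringEnumeration = filterEnumeration (coloringEnumeration N) fixed?
    (λ c≗c′ fixed u → trans (sym (c≗c′ (γ u))) (trans (fixed u) (c≗c′ u)))

  fixed-rep : ∀ {c} → Fixed c → ∀ v → c (rep v) ≡ c v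
  fixed-rep {c} fixed v with rep-~ v
  ... | j , eq = trans (cong c (sym eq)) (constant-on-orbit j)
    where
    constant-on-orbit : ∀ j → c (iter γ j v) ≡ c v
    constant-on-orbit zero = refl
    constant-on-orbit (suc j) = trans (fixed _) (constant-on-orbit j)

  W-constant-on-cycles : ∀ (c : Fin N → Y F) → (∀ v → c (rep v) ≡ c v) →
    W F c ≡ +ᵛ-sum.∑ (allFin N) (λ r → +ᵛ-sum.[ rep r ≟ᶠ r ]· Vec.map (len r *_) (wt F (c r)))
  W-constant-on-cycles c c-rep = begin
    W F c                                     ≡⟨ W-as-sum c ⟩
    +ᵛ-sum.∑ (allFin N) (wt F ∘ c)             ≡⟨ ∑-by-cycles (+ᵛ-commutativeMonoid n) (wt F ∘ c) ⟩
    +ᵛ-sum.∑ (allFin N) (λ r → +ᵛ-sum.[ rep r ≟ᶠ r ]·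
      +ᵛ-sum.∑ (allFin N) (λ v → +ᵛ-sum.[ rep v ≟ᶠ r ]· wt F (c v)))
      ≡⟨ +ᵛ-sum.∑-cong (allFin N) cycle-weight ⟩
    +ᵛ-sum.∑ (allFin N) (λ r → +ᵛ-sum.[ rep r ≟ᶠ r ]· Vec.map (len r *_) (wt F (c r))) ∎
    where
    open ≡-Reasoning
    cycle-weight : ∀ r →
      +ᵛ-sum.[ rep r ≟ᶠ r ]· +ᵛ-sum.∑ (allFin N) (λ v → +ᵛ-sum.[ rep v ≟ᶠ r ]· wt F (c v))
                         ≡ +ᵛ-sum.[ rep r ≟ᶠ r ]· Vec.map (len r *_) (wt F (c r))
    cycle-weight r with rep r ≟ᶠ r
    ... | no _ = refl
    ... | yes rep≡r = begin
        +ᵛ-sum.∑ (allFin N) (λ v → +ᵛ-sum.[ rep v ≟ᶠ r ]· wt F (c v))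
      ≡⟨ +ᵛ-sum.∑-cong (allFin N) same-color ⟩
        +ᵛ-sum.∑ (allFin N) (λ v → +ᵛ-sum.[ rep v ≟ᶠ r ]· wt F (c r))
      ≡⟨ ∑-[]·-constᵛ (allFin N) (λ v → rep v ≟ᶠ r) (wt F (c r)) ⟩
        Vec.map (ℕ-sum.∑ (allFin N) (λ v → ℕ-sum.[ rep v ≟ᶠ r ]· 1) *_) (wt F (c r))
      ≡⟨ cong (λ k → Vec.map (k *_) (wt F (c r))) (cycle-size r rep≡r) ⟩
        Vec.map (len r *_) (wt F (c r))
      ∎
      where
      same-color : ∀ v → +ᵛ-sum.[ rep v ≟ᶠ r ]· wt F (c v) ≡ +ᵛ-sum.[ rep v ≟ᶠ r ]· wt F (c r)
      same-color v with rep v ≟ᶠ r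
      ... | yes rep≡ = cong (wt F) (trans (sym (c-rep v)) (cong c rep≡))
      ... | no _ = refl

  restrictToReps : (Fin N → Y F) → DecSetoid.Carrier (Restrictedˢ isRep)
  restrictToReps c v = embed (isRep v) (c v)

  private
    isRep-rep : ∀ v → T (isRep (rep v))
    isRep-rep v with rep (rep v) ≟ᶠ rep v
    ... | yes _ = tt
    ... | no rep≢ = ⊥-elim (rep≢ (rep-idem v))

    isRep⇒rep≡ : ∀ v → T (isRep v) → rep v ≡ v
    isRep⇒rep≡ v p with rep v ≟ᶠ v
    ... | yes rep≡ = rep≡

    extract-at : ∀ (d : DecSetoid.Carrier (Restrictedˢ isRep)) {u v} → u ≡ v → (p : T (isRep u)) (q : T (isRep v)) →
         extract (isRep u) p (d u) ≡ extract (isRep v) q (d v)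
    extract-at d {u} refl p q = extract-irrelevant (isRep u) p q (d u)

  extendFromReps : DecSetoid.Carrier (Restrictedˢ isRep) → (Fin N → Y F)
  extendFromReps d v = extract (isRep (rep v)) (isRep-rep v) (d (rep v))

  fixed↔restricted : Bijection (Coloringˢ N) (Restrictedˢ isRep) (λ c → ⊤ × Fixed c) (λ _ → ⊤)
  fixed↔restricted = record
    { to = restrictToReps
    ; from = extendFromReps
    ; to-cong = λ c≗c′ v → DecSetoid.reflexive (Factorˢ (isRep v)) (cong (embed (isRep v)) (c≗c′ v))
    ; from-cong = λ {d} {d′} d≈d′ v → extract-cong (isRep (rep v)) (isRep-rep v) (d≈d′ (rep v))
    ; to-P = λ _ → tt
    ; from-P = λ {d} _ → tt , λ u → extract-at d (sym (rep-cong (1 , refl))) (isRep-rep (γ u)) (isRep-rep u)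
    ; from∘to = λ { {c} (_ , fixed) v → trans (extract-embed (isRep (rep v)) (isRep-rep v) (c (rep v))) (fixed-rep fixed v) }
    ; to∘from = λ {d} _ v → Factor-≈ (isRep v) (λ p → DecSetoid.trans (Factorˢ (isRep v))
        (DecSetoid.reflexive (Factorˢ (isRep v)) (cong (embed (isRep v)) (extract-at d (isRep⇒rep≡ v p) (isRep-rep v) p)))
        (embed-extract (isRep v) p (d v)))
    }

  restrictToReps-weight : ∀ {c} → Fixed c → restrictedWeight isRep lenPred (restrictToReps c) ≡ W F c
  restrictToReps-weight {c} fixed = begin
    restrictedWeight isRep lenPred (restrictToReps c)
      ≡⟨ restrictedWeight-as-sum isRep lenPred (restrictToReps c) ⟩
    +ᵛ-sum.∑ (allFin N) (λ v → factorWeight (isRep v) (lenPred v) (embed (isRep v) (c v)))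
      ≡⟨ +ᵛ-sum.∑-cong (allFin N) (λ v → factorWeight-embed (rep v ≟ᶠ v) (lenPred v) (c v)) ⟩
    +ᵛ-sum.∑ (allFin N) (λ r → +ᵛ-sum.[ rep r ≟ᶠ r ]· Vec.map (len r *_) (wt F (c r)))
      ≡⟨ sym (W-constant-on-cycles c (fixed-rep fixed)) ⟩
    W F c ∎
    where open ≡-Reasoning

  series-fixedColoringEnumeration : series fixedColoringEnumeration ≗ ∏factors isRep lenPred
  series-fixedColoringEnumeration e =
    trans (series-≗ (WeightedEnumeration.w-cong (restrictedEnumeration isRep lenPred)) fixed↔restricted
                    (λ (_ , fixed) → restrictToReps-weight fixed)
                    fixedColoringEnumeration (restrictedEnumeration isRep lenPred) e)
          (series-restrictedEnumeration isRep lenPred e)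

  numCycles≡multiplicity : ∀ i → numCycles γ i ≡ multiplicity isRep lenPred i
  numCycles≡multiplicity i = begin
    length (filter (OnCycle? γ i) (allFin N)) /ℕ suc i
      ≡⟨ cong (_/ℕ suc i) (trans (ℕ-sum.length-filter (OnCycle? γ i) (allFin N)) (points-on-cycles i)) ⟩
    (suc i * reps) /ℕ suc i
      ≡⟨ cong (_/ℕ suc i) (ℕ.*-comm (suc i) reps) ⟩
    (reps * suc i) /ℕ suc i
      ≡⟨ m*n/n≡m reps (suc i) ⟩
    reps
      ≡⟨ ℕ-sum.∑-cong (allFin N) rep-on-cycle ⟩
    multiplicity isRep lenPred i ∎
    where
    open ≡-Reasoning
    open ℕ-sum using ([_]·_)
    reps : ℕ
    reps = ℕ-sum.∑ (allFin N) (λ r → [ rep r ≟ᶠ r ]· [ OnCycle? γ i r ]· 1)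
    rep-on-cycle : ∀ r → [ rep r ≟ᶠ r ]· [ OnCycle? γ i r ]· 1 ≡ (if isRep r then [ lenPred r ≟ i ]· 1 else 0)
    rep-on-cycle r = trans ([]·-if (rep r ≟ᶠ r) _) (cong (if isRep r then_else 0)
      (ℕ-sum.[]·-⇔ (OnCycle? γ i r) (lenPred r ≟ i) 1 lenPred-onCycle (λ { refl → onCycle r })))

  polya : ∀ e → substCycleIndex (figSeries F) γ e ≡ length (filter fixed? (colorings F N e))
  polya e = begin
    ∏dilations (upTo N) (numCycles γ) e
      ≡⟨ cong (λ Q → Q e) (∏dilations-cong (upTo N) (All.universal numCycles≡multiplicity _)) ⟩
    ∏dilations (upTo N) (multiplicity isRep lenPred) e
      ≡⟨ sym (∏factors-regroup N isRep lenPred (λ v _ → lenPred<N v) e) ⟩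
    ∏factors isRep lenPred e
      ≡⟨ sym (series-fixedColoringEnumeration e) ⟩
    length (filter fixed? (colorings F N e)) ∎
    where open ≡-Reasoning

Perm : ℕ → Set
Perm N = Fin N → Fin N

Finˢ : ℕ → DecSetoid 0ℓ 0ℓ
Finˢ = Fin.≡-decSetoid

Permˢ : ℕ → DecSetoid 0ℓ 0ℓ
Permˢ N = Pointwise.decSetoid (Finˢ N) N

IsPermutation : ∀ {N} → Perm N → Set
IsPermutation γ = (∀ u v → γ u ≡ γ v → u ≡ v) × (∀ v → ∃ λ u → γ u ≡ v)

inv : ∀ {N} → Perm N → Perm N
inv γ v = firstOr (λ u → does (γ u ≟ᶠ v)) v

module _ {N : ℕ} {γ : Perm N} (γ-perm : IsPermutation γ) where
  private
    injective : ∀ u v → γ u ≡ γ v → u ≡ v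
    injective = proj₁ γ-perm
    surjective : ∀ v → ∃ λ u → γ u ≡ v
    surjective = proj₂ γ-perm

  inv-right : ∀ v → γ (inv γ v) ≡ v
  inv-right v = does-sound (γ (inv γ v) ≟ᶠ v)
    (firstOr-sound (λ u → does (γ u ≟ᶠ v)) v (dec-true (γ _ ≟ᶠ v) (proj₂ (surjective v))))

  inv-left : ∀ u → inv γ (γ u) ≡ u
  inv-left u = injective _ _ (inv-right (γ u))

  inv-isPermutation : IsPermutation (inv γ)
  inv-isPermutation = (λ u v eq → trans (sym (inv-right u)) (trans (cong γ eq) (inv-right v))) ,
                      (λ v → γ v , inv-left v)

inv-inv : ∀ {N} {γ : Perm N} → IsPermutation γ → inv (inv γ) ≗ γ
inv-inv {γ = γ} γ-perm v = trans (cong (inv (inv γ)) (sym (inv-left γ-perm v)))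
                                 (inv-left (inv-isPermutation γ-perm) (γ v))

∘-isPermutation : ∀ {N} {γ δ : Perm N} → IsPermutation γ → IsPermutation δ → IsPermutation (δ ∘ γ)
∘-isPermutation {δ = δ} (γ-inj , γ-surj) (δ-inj , δ-surj) =
  (λ u v eq → γ-inj u v (δ-inj _ _ eq)) ,
  (λ v → proj₁ (γ-surj (proj₁ (δ-surj v))) , trans (cong δ (proj₂ (γ-surj _))) (proj₂ (δ-surj v)))

record PermutationGroup (N : ℕ) : Set₁ where
  field
    Member      : Perm N → Set
    member-cong : ∀ {γ γ′} → γ ≗ γ′ → Member γ → Member γ′
    member-perm : ∀ {γ} → Member γ → IsPermutation γ
    member-id   : Member id
    member-∘    : ∀ {γ δ} → Member γ → Member δ → Member (δ ∘ γ)
    member-inv  : ∀ {γ} → Member γ → Member (inv γ)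
    elements    : List (Perm N)
    enumerates  : Enumerates (Permˢ N) Member elements

  order : ℕ
  order = length elements

  order-positive : ∃ λ k → order ≡ suc k
  order-positive = nonempty (Enumerates.complete enumerates member-id)
    where
    nonempty : ∀ {P : Perm N → Set} {xs} → Any P xs → ∃ λ k → length xs ≡ suc k
    nonempty {xs = _ ∷ xs} _ = length xs , refl

  module _ {δ : Perm N} (δ∈ : Member δ) where
    private
      δ-perm : IsPermutation δ
      δ-perm = member-perm δ∈

    left-translation : Bijection (Permˢ N) (Permˢ N) Member Member
    left-translation = record
      { to = δ ∘_ ; from = inv δ ∘_
      ; to-cong = λ γ≗ u → cong δ (γ≗ u) ; from-cong = λ γ≗ u → cong (inv δ) (γ≗ u)
      ; to-P = λ γ∈ → member-∘ γ∈ δ∈ ; from-P = λ γ∈ → member-∘ γ∈ (member-inv δ∈)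
      ; from∘to = λ _ u → inv-left δ-perm _ ; to∘from = λ _ u → inv-right δ-perm _ }

    right-translation : Bijection (Permˢ N) (Permˢ N) Member Member
    right-translation = record
      { to = _∘ δ ; from = _∘ inv δ
      ; to-cong = λ γ≗ u → γ≗ (δ u) ; from-cong = λ γ≗ u → γ≗ (inv δ u)
      ; to-P = λ γ∈ → member-∘ δ∈ γ∈ ; from-P = λ γ∈ → member-∘ (member-inv δ∈) γ∈
      ; from∘to = λ {γ} _ u → cong γ (inv-right δ-perm u) ; to∘from = λ {γ} _ u → cong γ (inv-left δ-perm u) }

    conjugation : Bijection (Permˢ N) (Permˢ N) Member Member
    conjugation = record
      { to = λ κ → δ ∘ κ ∘ inv δ ; from = λ κ → inv δ ∘ κ ∘ δ
      ; to-cong = λ κ≗ u → cong δ (κ≗ (inv δ u)) ; from-cong = λ κ≗ u → cong (inv δ) (κ≗ (δ u))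
      ; to-P = λ κ∈ → member-∘ (member-∘ (member-inv δ∈) κ∈) δ∈
      ; from-P = λ κ∈ → member-∘ (member-∘ δ∈ κ∈) (member-inv δ∈)
      ; from∘to = λ {κ} _ u → trans (inv-left δ-perm _) (cong κ (inv-left δ-perm u))
      ; to∘from = λ {κ} _ u → trans (inv-right δ-perm _) (cong κ (inv-right δ-perm u)) }

module ClassSums {A : Set} {_~_ : A → A → Set} (_~?_ : ∀ x y → Dec (x ~ y))
                 (~-sym : ∀ {x y} → x ~ y → y ~ x) (~-trans : ∀ {x y z} → x ~ y → y ~ z → x ~ z) where
  open ℕ-sum using (∑; [_]·_)

  -- Like countClasses, but adding g over the last element of each class.
  ∑-classes : List A → (A → ℕ) → ℕ
  ∑-classes [] g = 0
  ∑-classes (x ∷ xs) g = (if does (Any.any? (x ~?_) xs) then 0 else g x) + ∑-classes xs g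

  ∑-classes-congᴬ : ∀ {xs} {g g′ : A → ℕ} → All (λ x → g x ≡ g′ x) xs →
                    ∑-classes xs g ≡ ∑-classes xs g′
  ∑-classes-congᴬ [] = refl
  ∑-classes-congᴬ {x ∷ xs} (g≡ ∷ gs≡) with Any.any? (x ~?_) xs
  ... | yes _ = ∑-classes-congᴬ gs≡
  ... | no _ = cong₂ _+_ g≡ (∑-classes-congᴬ gs≡)

  ∑-classes-const : ∀ xs m → ∑-classes xs (λ _ → m) ≡ m * countClasses _~?_ xs
  ∑-classes-const [] m = sym (ℕ.*-zeroʳ m)
  ∑-classes-const (x ∷ xs) m with Any.any? (x ~?_) xs
  ... | yes _ = ∑-classes-const xs m
  ... | no _ = trans (cong (_+_ m) (∑-classes-const xs m)) (sym (ℕ.*-suc m _))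

  ∑-by-classes : ∀ (K L : List A) (f : A → ℕ) →
    ∑ K (λ c → [ Any.any? (_~? c) L ]· f c) ≡ ∑-classes L (λ x → ∑ K (λ c → [ x ~? c ]· f c))
  ∑-by-classes K [] f = ℕ-sum.∑-ε K
  ∑-by-classes K (x ∷ xs) f with Any.any? (x ~?_) xs
  ... | yes x~later = trans (ℕ-sum.∑-cong K (λ c → ℕ-sum.[]·-⇔ (Any.any? (_~? c) (x ∷ xs)) (Any.any? (_~? c) xs) (f c)
      (λ { (here x~c) → Any.map (λ x~y → ~-trans (~-sym x~y) x~c) x~later ; (there y~c) → y~c }) there))
    (∑-by-classes K xs f)
  ... | no x~no-later = trans (ℕ-sum.∑-cong K split) (trans (ℕ-sum.∑-∙ K _ _) (cong (_+_ _) (∑-by-classes K xs f)))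
    where
    split : ∀ c → [ Any.any? (_~? c) (x ∷ xs) ]· f c ≡ [ x ~? c ]· f c + [ Any.any? (_~? c) xs ]· f c
    split c with x ~? c | Any.any? (_~? c) xs
    ... | yes x~c | yes y~c = ⊥-elim (x~no-later (Any.map (λ y~c → ~-trans x~c (~-sym y~c)) y~c))
    ... | yes _ | no _ = sym (ℕ.+-identityʳ (f c))
    ... | no _ | yes _ = refl
    ... | no _ | no _ = refl

record Action {N} (H : PermutationGroup N) (X : DecSetoid 0ℓ 0ℓ) (Domain : DecSetoid.Carrier X → Set) : Set₁ where
  open PermutationGroup H using (Member)
  open DecSetoid X using (Carrier; _≈_)
  field
    Carries            : Perm N → Carrier → Carrier → Set
    carries?           : ∀ γ x y → Dec (Carries γ x y)
    carries-cong       : ∀ {γ γ′ x x′ y y′} → γ ≗ γ′ → x ≈ x′ → y ≈ y′ →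
                         Carries γ x y → Carries γ′ x′ y′
    carries-id         : ∀ x → Carries id x x
    carries-∘          : ∀ {γ δ x y z} → Carries γ x y → Carries δ y z → Carries (δ ∘ γ) x z
    carries-inv        : ∀ {γ x y} → Member γ → Carries γ x y → Carries (inv γ) y x
    carries-functional : ∀ {γ x y y′} → Member γ → Carries γ x y → Carries γ x y′ → y ≈ y′
    act                : Perm N → Carrier → Carrier
    act-cong           : ∀ {γ x x′} → x ≈ x′ → act γ x ≈ act γ x′
    act-domain         : ∀ {γ x} → Member γ → Domain x → Domain (act γ x)
    carries-act        : ∀ {γ x} → Member γ → Domain x → Carries γ x (act γ x)
    points             : List Carrier
    points-enumerate   : Enumerates X Domain points

module OrbitCounting {N : ℕ} {H : PermutationGroup N} {X : DecSetoid 0ℓ 0ℓ} {Domain : DecSetoid.Carrier X → Set}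
                     (A : Action H X Domain) where
  open PermutationGroup H
  open Action A
  open DecSetoid X using (Carrier; _≈_) renaming (refl to ≈-refl; sym to ≈-sym; trans to ≈-trans)
  open ℕ-sum using (∑; [_]·_)
  private
    module H = Enumerates enumerates
    module P = Enumerates points-enumerate

  _~_ : Carrier → Carrier → Set
  x ~ y = Any (λ h → Carries h x y) elements

  _~?_ : ∀ x y → Dec (x ~ y)
  x ~? y = Any.any? (λ h → carries? h x y) elements

  private
    member-witness : ∀ {P : Perm N → Set} → Any P elements → ∃ λ h → Member h × P h
    member-witness any = Any.lookup any , All.lookupAny H.sound any

  ~-refl : ∀ {x} → x ~ x
  ~-refl {x} = Any.map (λ id≗h → carries-cong id≗h ≈-refl ≈-refl (carries-id x)) (H.complete member-id)

  ~-sym : ∀ {x y} → x ~ y → y ~ x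
  ~-sym x~y with member-witness x~y
  ... | h , h∈ , carries = Any.map (λ inv≗ → carries-cong inv≗ ≈-refl ≈-refl (carries-inv h∈ carries))
                                   (H.complete (member-inv h∈))

  ~-trans : ∀ {x y z} → x ~ y → y ~ z → x ~ z
  ~-trans x~y y~z with member-witness x~y | member-witness y~z
  ... | h , h∈ , carries | h′ , h′∈ , carries′ =
    Any.map (λ ∘≗ → carries-cong ∘≗ ≈-refl ≈-refl (carries-∘ carries carries′))
            (H.complete (member-∘ h∈ h′∈))

  transporters : Carrier → Carrier → ℕ
  transporters x y = ∑ elements (λ h → [ carries? h x y ]· 1)

  private
    transporters-reindex : ∀ (φ : Bijection (Permˢ N) (Permˢ N) Member Member) {x y x′ y′} →
      (∀ {h} → Member h → Carries (Bijection.to φ h) x y → Carries h x′ y′) →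
      (∀ {h} → Member h → Carries h x′ y′ → Carries (Bijection.to φ h) x y) →
      transporters x y ≡ transporters x′ y′
    transporters-reindex φ {x} {y} {x′} {y′} forth back = trans
      (sym (∑-reindex ℕ.+-0-commutativeMonoid enumerates enumerates φ (λ h → [ carries? h x y ]· 1)
        (λ h≗ → ℕ-sum.[]·-⇔ (carries? _ x y) (carries? _ x y) 1
          (carries-cong h≗ ≈-refl ≈-refl) (carries-cong (λ u → sym (h≗ u)) ≈-refl ≈-refl))))
      (ℕ-sum.∑-congᴬ (All.map (λ h∈ → ℕ-sum.[]·-⇔ (carries? _ x y) (carries? _ x′ y′) 1 (forth h∈) (back h∈))
                              H.sound))

    cancel-inv : ∀ {δ} → Member δ → ∀ (h : Perm N) → h ≗ (inv δ ∘ δ ∘ h)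
    cancel-inv {δ} δ∈ h u = sym (inv-left (member-perm δ∈) (h u))

  transporters-source : ∀ {δ x y} → Member δ → Carries δ x y → transporters x y ≡ transporters x x
  transporters-source {δ} δ∈ δxy = transporters-reindex (left-translation δ∈)
    (λ {h} _ carries → carries-cong (λ u → sym (cancel-inv {δ} δ∈ h u)) ≈-refl ≈-refl
                                   (carries-∘ carries (carries-inv δ∈ δxy)))
    (λ _ carries → carries-∘ carries δxy)

  transporters-target : ∀ {δ x y} → Member δ → Carries δ x y → transporters x y ≡ transporters y y
  transporters-target {δ} δ∈ δxy = transporters-reindex (right-translation δ∈)
    (λ {h} _ carries → carries-cong (λ u → cong h (inv-right (member-perm δ∈) u)) ≈-refl ≈-refl
                                   (carries-∘ (carries-inv δ∈ δxy) carries))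
    (λ _ carries → carries-∘ δxy carries)

  orbit-sum : ∀ {x} → Domain x → ∑ points (transporters x) ≡ order
  orbit-sum {x} x∈ = trans (ℕ-sum.∑-comm points elements (λ c h → [ carries? h x c ]· 1))
    (trans (ℕ-sum.∑-congᴬ (All.map hits-once H.sound)) (ℕ-sum.∑-one elements))
    where
    hits-once : ∀ {h} → Member h → ∑ points (λ c → [ carries? h x c ]· 1) ≡ 1
    hits-once h∈ = ℕ-sum.∑-[]·-single (carries? _ x) (λ _ → 1) P.sound P.unique
      (λ _ _ c≉c′ carries carries′ → c≉c′ (carries-functional h∈ carries carries′))
      (Any.map (λ act≈c → carries-cong (λ _ → refl) ≈-refl act≈c (carries-act h∈ x∈))
        (P.complete (act-domain h∈ x∈)))
      (λ _ _ → refl)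

  fixed-count : Perm N → ℕ
  fixed-count h = length (filter (λ x → carries? h x x) points)

  -- Σ_h |Fix h| = Σ_c |Stab c|, and the stabilizer sizes along one orbit add up to |H|.
  burnside : ∑ elements fixed-count ≡ order * countClasses _~?_ points
  burnside = begin
    ∑ elements fixed-count
      ≡⟨ ℕ-sum.∑-cong elements (λ h → ℕ-sum.length-filter (λ x → carries? h x x) points) ⟩
    ∑ elements (λ h → ∑ points (λ c → [ carries? h c c ]· 1))
      ≡⟨ ℕ-sum.∑-comm elements points (λ h c → [ carries? h c c ]· 1) ⟩
    ∑ points (λ c → transporters c c)
      ≡⟨ ℕ-sum.∑-congᴬ (All.tabulate (λ c∈ → sym (ℕ-sum.[]·-yes (Any.any? (_~? _) points) _
           (Any.map (λ { refl → ~-refl }) c∈)))) ⟩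
    ∑ points (λ c → [ Any.any? (_~? c) points ]· transporters c c)
      ≡⟨ ∑-by-classes points points (λ c → transporters c c) ⟩
    ∑-classes points (λ x → ∑ points (λ c → [ x ~? c ]· transporters c c))
      ≡⟨ ∑-classes-congᴬ (All.map orbit-total P.sound) ⟩
    ∑-classes points (λ _ → order)
      ≡⟨ ∑-classes-const points order ⟩
    order * countClasses _~?_ points ∎
    where
    open ≡-Reasoning
    open ClassSums _~?_ ~-sym ~-trans
    orbit-total : ∀ {x} → Domain x → ∑ points (λ c → [ x ~? c ]· transporters c c) ≡ order
    orbit-total {x} x∈ = trans (ℕ-sum.∑-cong points within-orbit) (orbit-sum x∈)
      where
      within-orbit : ∀ c → [ x ~? c ]· transporters c c ≡ transporters x c
      within-orbit c with x ~? c
      ... | yes x~c with member-witness x~c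
      ...   | δ , δ∈ , carries = sym (transporters-target δ∈ carries)
      within-orbit c | no x≁c = sym (ℕ-sum.∑-[]·-none (λ h → carries? h x c) (λ _ → 1)
        (Allₚ.¬Any⇒All¬ elements x≁c))

  carries-conj : ∀ {δ κ x y} → Member δ → Carries δ y x →
                 (Carries (δ ∘ κ ∘ inv δ) x x → Carries κ y y) × (Carries κ y y → Carries (δ ∘ κ ∘ inv δ) x x)
  carries-conj {δ} {κ} δ∈ δyx =
    (λ carries → carries-cong cancel ≈-refl ≈-refl (carries-∘ (carries-∘ δyx carries) (carries-inv δ∈ δyx))) ,
    (λ carries → carries-∘ (carries-∘ (carries-inv δ∈ δyx) carries) δyx)
    where
    cancel : inv δ ∘ (δ ∘ κ ∘ inv δ) ∘ δ ≗ κ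
    cancel u = trans (inv-left (member-perm δ∈) _) (cong κ (inv-left (member-perm δ∈) u))

  fixed-count-conj : ∀ {δ} κ → Member δ → fixed-count (δ ∘ κ ∘ inv δ) ≡ fixed-count κ
  fixed-count-conj {δ} κ δ∈ = begin
    fixed-count (δ ∘ κ ∘ inv δ)
      ≡⟨ ℕ-sum.length-filter (λ x → carries? (δ ∘ κ ∘ inv δ) x x) points ⟩
    ∑ points (λ x → [ carries? (δ ∘ κ ∘ inv δ) x x ]· 1)
      ≡⟨ sym (∑-reindex ℕ.+-0-commutativeMonoid points-enumerate points-enumerate act-by-δ _
           (λ x≈ → ℕ-sum.[]·-⇔ (carries? _ _ _) (carries? _ _ _) 1 (carries-cong (λ _ → refl) x≈ x≈)
                     (carries-cong (λ _ → refl) (≈-sym x≈) (≈-sym x≈)))) ⟩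
    ∑ points (λ y → [ carries? (δ ∘ κ ∘ inv δ) (act δ y) (act δ y) ]· 1)
      ≡⟨ ℕ-sum.∑-congᴬ (All.map (λ y∈ → ℕ-sum.[]·-⇔ (carries? _ _ _) (carries? κ _ _) 1
           (proj₁ (carries-conj δ∈ (carries-act δ∈ y∈))) (proj₂ (carries-conj δ∈ (carries-act δ∈ y∈)))) P.sound) ⟩
    ∑ points (λ y → [ carries? κ y y ]· 1)
      ≡⟨ sym (ℕ-sum.length-filter (λ y → carries? κ y y) points) ⟩
    fixed-count κ ∎
    where
    open ≡-Reasoning
    δ-perm : IsPermutation δ
    δ-perm = member-perm δ∈
    act-by-δ : Bijection X X Domain Domain
    act-by-δ = record
      { to = act δ ; from = act (inv δ) ; to-cong = act-cong ; from-cong = act-cong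
      ; to-P = act-domain δ∈ ; from-P = act-domain (member-inv δ∈)
      ; from∘to = λ y∈ → carries-functional (member-inv δ∈)
          (carries-act (member-inv δ∈) (act-domain δ∈ y∈)) (carries-inv δ∈ (carries-act δ∈ y∈))
      ; to∘from = λ x∈ → carries-functional δ∈ (carries-act δ∈ (act-domain (member-inv δ∈) x∈))
          (carries-cong (inv-inv δ-perm) ≈-refl ≈-refl
            (carries-inv (member-inv δ∈) (carries-act (member-inv δ∈) x∈))) }

  fixed-count-cong : ∀ {γ γ′} → γ ≗ γ′ → fixed-count γ ≡ fixed-count γ′
  fixed-count-cong {γ} {γ′} γ≗ = trans (ℕ-sum.length-filter (λ x → carries? γ x x) points)
    (trans (ℕ-sum.∑-cong points (λ x → ℕ-sum.[]·-⇔ (carries? γ x x) (carries? γ′ x x) 1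
              (carries-cong γ≗ ≈-refl ≈-refl) (carries-cong (λ u → sym (γ≗ u)) ≈-refl ≈-refl)))
      (sym (ℕ-sum.length-filter (λ x → carries? γ′ x x) points)))

  orbit-stabilizer : ∀ {x} → Domain x → (g : Carrier → ℕ) → (∀ {y y′} → y ≈ y′ → g y ≡ g y′) →
                     (∀ {δ y} → Member δ → Carries δ x y → g y ≡ g x) →
                     transporters x x * ∑ points (λ y → [ x ~? y ]· g y) ≡ order * g x
  orbit-stabilizer {x} x∈ g g-cong g-invariant = begin
    transporters x x * ∑ points (λ y → [ x ~? y ]· g y)
      ≡⟨ sym (ℕ-sum.∑-*ˡ points (transporters x x) _) ⟩
    ∑ points (λ y → transporters x x * [ x ~? y ]· g y)
      ≡⟨ ℕ-sum.∑-cong points transporters-to ⟩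
    ∑ points (λ y → ∑ elements (λ δ → [ carries? δ x y ]· g y))
      ≡⟨ ℕ-sum.∑-comm points elements _ ⟩
    ∑ elements (λ δ → ∑ points (λ y → [ carries? δ x y ]· g y))
      ≡⟨ ℕ-sum.∑-congᴬ (All.map image H.sound) ⟩
    ∑ elements (λ _ → g x)
      ≡⟨ ℕ-sum.∑-const elements (g x) ⟩
    order * g x ∎
    where
    open ≡-Reasoning
    transporters-to : ∀ y → transporters x x * [ x ~? y ]· g y ≡ ∑ elements (λ δ → [ carries? δ x y ]· g y)
    transporters-to y with x ~? y
    ... | yes x~y with member-witness x~y
    ...   | δ , δ∈ , carries = trans (cong (_* g y) (sym (transporters-source δ∈ carries)))
      (ℕ-sum.∑-[]·1-* (λ δ → carries? δ x y) elements (g y))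
    transporters-to y | no x≁y = trans (ℕ.*-zeroʳ (transporters x x))
      (sym (ℕ-sum.∑-[]·-none (λ δ → carries? δ x y) (λ _ → g y) (Allₚ.¬Any⇒All¬ elements x≁y)))
    image : ∀ {δ} → Member δ → ∑ points (λ y → [ carries? δ x y ]· g y) ≡ g x
    image δ∈ = ℕ-sum.∑-[]·-single (carries? _ x) g P.sound P.unique
      (λ _ _ y≉y′ carries carries′ → y≉y′ (carries-functional δ∈ carries carries′))
      (Any.map (λ act≈y → carries-cong (λ _ → refl) ≈-refl act≈y (carries-act δ∈ x∈))
               (P.complete (act-domain δ∈ x∈)))
      (λ _ carries → g-invariant δ∈ carries)

  ∑-by-orbits : ∀ {R : List Carrier} → All Domain R →
                AllPairs (λ x y → ¬ (∃ λ δ → Member δ × Carries δ x y)) R →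
                (∀ y → Domain y → ∃ λ x → x Membership.∈ R × ∃ λ δ → Member δ × Carries δ x y) →
                (g : Carrier → ℕ) → ∑ points g ≡ ∑ R (λ x → ∑ points (λ y → [ x ~? y ]· g y))
  ∑-by-orbits {R} R⊆ R-distinct R-covers g =
    trans (ℕ-sum.∑-congᴬ (All.map (λ y∈ → sym (one-orbit y∈)) P.sound)) (ℕ-sum.∑-comm points R _)
    where
    one-orbit : ∀ {y} → Domain y → ∑ R (λ x → [ x ~? y ]· g y) ≡ g y
    one-orbit {y} y∈ = ℕ-sum.∑-[]·-single (_~? y) (λ _ → g y) R⊆ R-distinct
      (λ _ _ x≁x′ x~y x′~y → x≁x′ (member-witness (~-trans x~y (~-sym x′~y))))
      (let x , x∈R , δ , δ∈ , carries = R-covers y y∈ in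
         Any.map (λ { refl → Any.map (λ δ≗ → carries-cong δ≗ ≈-refl ≈-refl carries) (H.complete δ∈) }) x∈R)
      (λ _ _ → refl)

module _ {N : ℕ} {H : PermutationGroup N} {X : DecSetoid 0ℓ 0ℓ} {Domain : DecSetoid.Carrier X → Set}
         (A : Action H X Domain) where
  open PermutationGroup H
  open Action A
  open DecSetoid X using (Carrier) renaming (refl to ≈-refl)

  stabilizer : Carrier → PermutationGroup N
  stabilizer x = record
    { Member = λ γ → Member γ × Carries γ x x
    ; member-cong = λ γ≗ (γ∈ , carries) → member-cong γ≗ γ∈ , carries-cong γ≗ ≈-refl ≈-refl carries
    ; member-perm = member-perm ∘ proj₁
    ; member-id = member-id , carries-id x
    ; member-∘ = λ (γ∈ , carries) (δ∈ , carries′) → member-∘ γ∈ δ∈ , carries-∘ carries carries′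
    ; member-inv = λ (γ∈ , carries) → member-inv γ∈ , carries-inv γ∈ carries
    ; elements = filter (λ γ → carries? γ x x) elements
    ; enumerates = enumerates-filter enumerates (λ γ → carries? γ x x) (λ γ≗ → carries-cong γ≗ ≈-refl ≈-refl) }

module _ {N : ℕ} {H : PermutationGroup N} {X Z : DecSetoid 0ℓ 0ℓ}
         {D : DecSetoid.Carrier X → Set} {D′ : DecSetoid.Carrier Z → Set}
         (A : Action H X D) (B : Action H Z D′) where
  open PermutationGroup H
  open ℕ-sum using (∑; [_]·_)
  private
    module A = Action A
    module A′ = OrbitCounting A
    module B = OrbitCounting B

  stabilizer-fixed-count : DecSetoid.Carrier X → ℕ
  stabilizer-fixed-count x = ∑ elements (λ γ → [ A.carries? γ x x ]· B.fixed-count γ)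

  stabilizer-fixed-count-invariant : ∀ {δ x y} → Member δ → A.Carries δ x y →
                                     stabilizer-fixed-count y ≡ stabilizer-fixed-count x
  stabilizer-fixed-count-invariant {δ} {x} {y} δ∈ δxy = begin
    ∑ elements g
      ≡⟨ sym (∑-reindex ℕ.+-0-commutativeMonoid enumerates enumerates (conjugation δ∈) g g-cong) ⟩
    ∑ elements (λ κ → g (δ ∘ κ ∘ inv δ))
      ≡⟨ ℕ-sum.∑-congᴬ (All.map conjugate (Enumerates.sound enumerates)) ⟩
    ∑ elements (λ κ → [ A.carries? κ x x ]· B.fixed-count κ) ∎
    where
    open ≡-Reasoning
    open DecSetoid X using () renaming (refl to ≈-refl)
    g : Perm N → ℕ
    g γ = [ A.carries? γ y y ]· B.fixed-count γ
    g-cong : ∀ {γ γ′} → γ ≗ γ′ → g γ ≡ g γ′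
    g-cong {γ} {γ′} γ≗ = trans (cong ([ A.carries? γ y y ]·_) (B.fixed-count-cong γ≗))
      (ℕ-sum.[]·-⇔ (A.carries? γ y y) (A.carries? γ′ y y) _
        (A.carries-cong γ≗ ≈-refl ≈-refl) (A.carries-cong (λ u → sym (γ≗ u)) ≈-refl ≈-refl))
    conjugate : ∀ {κ} → Member κ → g (δ ∘ κ ∘ inv δ) ≡ [ A.carries? κ x x ]· B.fixed-count κ
    conjugate {κ} _ = trans (cong ([ A.carries? (δ ∘ κ ∘ inv δ) y y ]·_) (B.fixed-count-conj κ δ∈))
      (ℕ-sum.[]·-⇔ (A.carries? _ y y) (A.carries? κ x x) _
        (proj₁ (A′.carries-conj δ∈ δxy)) (proj₂ (A′.carries-conj δ∈ δxy)))

module _ (S : DecSetoid 0ℓ 0ℓ) where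
  open DecSetoid S

  allFuns-enumerates : ∀ k {xs} → Enumerates S (λ _ → ⊤) xs →
                       Enumerates (Pointwise.decSetoid S k) (λ _ → ⊤) (allFuns k xs)
  allFuns-enumerates k {xs} X = record
    { sound = All.universal (λ _ → tt) _ ; unique = unique k ; complete = λ {f} _ → complete k f }
    where
    module X = Enumerates X
    unique : ∀ k → AllPairs (λ f g → ¬ (∀ i → f i ≈ g i)) (allFuns k xs)
    unique zero = [] ∷ []
    unique (suc k) = concatMap-AllPairs _
      (AllPairs.map (λ x≉y → Allₚ.map⁺ (All.universal (λ _ →
         Allₚ.map⁺ (All.universal (λ _ f≈g → x≉y (f≈g zero)) _)) _))
        X.unique)
      (All.universal (λ x → AllPairsₚ.map⁺ (AllPairs.map (λ f≉g f≈g → f≉g (f≈g ∘ suc)) (unique k))) xs)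
    complete : ∀ k (f : Fin k → Carrier) → Any (λ g → ∀ i → f i ≈ g i) (allFuns k xs)
    complete zero f = here (λ ())
    complete (suc k) f = Anyₚ.concatMap⁺ _ (Any.map (λ {x} f0≈x → Anyₚ.map⁺ (Any.map (λ {g} tail≈ →
        λ { zero → f0≈x ; (suc i) → tail≈ i }) (complete k (f ∘ suc)))) (X.complete {f zero} tt))

allFin-enumerates : ∀ N → Enumerates (Finˢ N) (λ _ → ⊤) (allFin N)
allFin-enumerates N = record
  { sound = All.universal (λ _ → tt) _ ; unique = allFin⁺ N ; complete = λ {v} _ → ∈-allFin v }

module Automorphisms {N : ℕ} (G : Graph N) where

  aut⇒perm : ∀ {γ} → IsAut G γ → IsPermutation γ
  aut⇒perm (injective , surjective , _) = injective , surjective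

  IsAut-cong : ∀ {γ γ′} → γ ≗ γ′ → IsAut G γ → IsAut G γ′
  IsAut-cong γ≗γ′ (injective , surjective , edges) =
    (λ u v eq → injective u v (trans (γ≗γ′ u) (trans eq (sym (γ≗γ′ v))))) ,
    (λ v → proj₁ (surjective v) , trans (sym (γ≗γ′ _)) (proj₂ (surjective v))) ,
    (λ u v → trans (cong₂ (E G) (sym (γ≗γ′ u)) (sym (γ≗γ′ v))) (edges u v))

  IsAut-id : IsAut G id
  IsAut-id = (λ u v eq → eq) , (λ v → v , refl) , (λ u v → refl)

  IsAut-∘ : ∀ {γ δ} → IsAut G γ → IsAut G δ → IsAut G (δ ∘ γ)
  IsAut-∘ {γ} γ-aut δ-aut with ∘-isPermutation (aut⇒perm γ-aut) (aut⇒perm δ-aut)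
  ... | injective , surjective = injective , surjective ,
    (λ u v → trans (proj₂ (proj₂ δ-aut) (γ u) (γ v)) (proj₂ (proj₂ γ-aut) u v))

  IsAut-inv : ∀ {γ} → IsAut G γ → IsAut G (inv γ)
  IsAut-inv {γ} γ-aut with inv-isPermutation (aut⇒perm γ-aut)
  ... | injective , surjective = injective , surjective ,
    (λ u v → trans (sym (proj₂ (proj₂ γ-aut) (inv γ u) (inv γ v)))
                   (cong₂ (E G) (inv-right (aut⇒perm γ-aut) u) (inv-right (aut⇒perm γ-aut) v)))

  automorphismGroup : PermutationGroup N
  automorphismGroup = record
    { Member = IsAut G ; member-cong = IsAut-cong ; member-perm = aut⇒perm
    ; member-id = IsAut-id ; member-∘ = IsAut-∘ ; member-inv = IsAut-inv
    ; elements = Aut G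
    ; enumerates = enumerates-⇔ (enumerates-filter (allFuns-enumerates (Finˢ N) N (allFin-enumerates N))
                     (IsAut? G) IsAut-cong) proj₂ (tt ,_) }

  Rotˢ : DecSetoid 0ℓ 0ℓ
  Rotˢ = Pointwise.decSetoid (Permˢ N) N

  private
    module Rot = DecSetoid Rotˢ

  IsMap-cong : ∀ {ρ ρ′} → ρ Rot.≈ ρ′ → IsMap G ρ → IsMap G ρ′
  IsMap-cong ρ≈ (fixes-non-neighbours , neighbours , injective , cyclic) =
    (λ v u ne → trans (sym (ρ≈ v u)) (fixes-non-neighbours v u ne)) ,
    (λ v u eu → subst (λ z → E G v z ≡ true) (ρ≈ v u) (neighbours v u eu)) ,
    (λ v u u′ eu eu′ eq → injective v u u′ eu eu′ (trans (ρ≈ v u) (trans eq (sym (ρ≈ v u′))))) ,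
    (λ v u u′ eu eu′ → let k , reaches = cyclic v u u′ eu eu′ in
       k , trans (sym (iter-cong (ρ≈ v) (toℕ k) u)) reaches)

  Maps-enumerates : Enumerates Rotˢ (IsMap G) (Maps G)
  Maps-enumerates = enumerates-⇔ (enumerates-filter
    (allFuns-enumerates (Permˢ N) N (allFuns-enumerates (Finˢ N) N (allFin-enumerates N))) (IsMap? G) IsMap-cong)
    proj₂ (tt ,_)

  Sends-cong : ∀ {γ γ′ ρ₁ ρ₁′ ρ₂ ρ₂′} → γ ≗ γ′ → ρ₁ Rot.≈ ρ₁′ → ρ₂ Rot.≈ ρ₂′ →
               Sends γ ρ₁ ρ₂ → Sends γ′ ρ₁′ ρ₂′
  Sends-cong {γ} {γ′} {ρ₁} {ρ₁′} {ρ₂} {ρ₂′} γ≗ ρ₁≈ ρ₂≈ sends v u =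
    trans (sym (ρ₂≈ (γ′ v) (γ′ u))) (trans (cong₂ ρ₂ (sym (γ≗ v)) (sym (γ≗ u)))
      (trans (sends v u) (trans (γ≗ (ρ₁ v u)) (cong γ′ (ρ₁≈ v u)))))

  Sends-∘ : ∀ {γ δ : Perm N} {ρ₁ ρ₂ ρ₃} → Sends γ ρ₁ ρ₂ → Sends δ ρ₂ ρ₃ → Sends (δ ∘ γ) ρ₁ ρ₃
  Sends-∘ {γ} {δ} sends sends′ v u = trans (sends′ (γ v) (γ u)) (cong δ (sends v u))

  push : Perm N → RotSys N → RotSys N
  push γ ρ v u = γ (ρ (inv γ v) (inv γ u))

  module _ {γ : Perm N} (γ-aut : IsAut G γ) where
    private
      γ-perm : IsPermutation γ
      γ-perm = aut⇒perm γ-aut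

    Sends-inv : ∀ {ρ₁ ρ₂} → Sends γ ρ₁ ρ₂ → Sends (inv γ) ρ₂ ρ₁
    Sends-inv {ρ₁} {ρ₂} sends v u = proj₁ γ-perm _ _ (trans (sym (sends (inv γ v) (inv γ u)))
      (trans (cong₂ ρ₂ (inv-right γ-perm v) (inv-right γ-perm u)) (sym (inv-right γ-perm _))))

    Sends-functional : ∀ {ρ ρ₁ ρ₂} → Sends γ ρ ρ₁ → Sends γ ρ ρ₂ → ρ₁ Rot.≈ ρ₂
    Sends-functional {ρ} {ρ₁} {ρ₂} sends₁ sends₂ v u =
      trans (cong₂ ρ₁ (sym (inv-right γ-perm v)) (sym (inv-right γ-perm u)))
        (trans (sends₁ (inv γ v) (inv γ u)) (trans (sym (sends₂ (inv γ v) (inv γ u)))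
          (cong₂ ρ₂ (inv-right γ-perm v) (inv-right γ-perm u))))

    Sends-push : ∀ ρ → Sends γ ρ (push γ ρ)
    Sends-push ρ v u = cong γ (cong₂ ρ (inv-left γ-perm v) (inv-left γ-perm u))

    IsMap-push : ∀ {ρ} → IsMap G ρ → IsMap G (push γ ρ)
    IsMap-push {ρ} (fixes-non-neighbours , neighbours , injective , cyclic) =
      fixes-non-neighbours′ , neighbours′ , injective′ , cyclic′
      where
      edges : ∀ v u → E G (inv γ v) (inv γ u) ≡ E G v u
      edges = proj₂ (proj₂ (IsAut-inv γ-aut))

      fixes-non-neighbours′ : ∀ v u → E G v u ≡ false → push γ ρ v u ≡ u
      fixes-non-neighbours′ v u ne =
        trans (cong γ (fixes-non-neighbours (inv γ v) (inv γ u) (trans (edges v u) ne))) (inv-right γ-perm u)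

      neighbours′ : ∀ v u → E G v u ≡ true → E G v (push γ ρ v u) ≡ true
      neighbours′ v u eu = trans (cong (λ z → E G z (push γ ρ v u)) (sym (inv-right γ-perm v)))
        (trans (proj₂ (proj₂ γ-aut) _ _) (neighbours (inv γ v) (inv γ u) (trans (edges v u) eu)))

      injective′ : ∀ v u u′ → E G v u ≡ true → E G v u′ ≡ true → push γ ρ v u ≡ push γ ρ v u′ → u ≡ u′
      injective′ v u u′ eu eu′ eq = trans (sym (inv-right γ-perm u)) (trans (cong γ
        (injective (inv γ v) (inv γ u) (inv γ u′) (trans (edges v u) eu) (trans (edges v u′) eu′)
                   (proj₁ γ-perm _ _ eq))) (inv-right γ-perm u′))

      iter-push : ∀ v k u → iter (push γ ρ v) k u ≡ γ (iter (ρ (inv γ v)) k (inv γ u))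
      iter-push v zero u = sym (inv-right γ-perm u)
      iter-push v (suc k) u =
        cong (λ z → γ (ρ (inv γ v) z)) (trans (cong (inv γ) (iter-push v k u)) (inv-left γ-perm _))

      cyclic′ : ∀ v u u′ → E G v u ≡ true → E G v u′ ≡ true → ∃ λ (k : Fin N) → iter (push γ ρ v) (toℕ k) u ≡ u′
      cyclic′ v u u′ eu eu′ with cyclic (inv γ v) (inv γ u) (inv γ u′) (trans (edges v u) eu) (trans (edges v u′) eu′)
      ... | k , reaches = k , trans (iter-push v (toℕ k) u) (trans (cong γ reaches) (inv-right γ-perm u′))

  mapAction : Action automorphismGroup Rotˢ (IsMap G)
  mapAction = record
    { Carries = Sends ; carries? = Sends? ; carries-cong = Sends-cong
    ; carries-id = λ ρ v u → refl
    ; carries-∘ = λ {γ} {δ} {ρ₁} {ρ₂} {ρ₃} → Sends-∘ {γ} {δ} {ρ₁} {ρ₂} {ρ₃}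
    ; carries-inv = λ γ-aut → Sends-inv γ-aut ; carries-functional = λ γ-aut → Sends-functional γ-aut
    ; act = push
    ; act-cong = λ {γ} ρ≈ v u → cong γ (ρ≈ (inv γ v) (inv γ u))
    ; act-domain = λ γ-aut → IsMap-push γ-aut ; carries-act = λ {_} {ρ} γ-aut _ → Sends-push γ-aut ρ
    ; points = Maps G ; points-enumerate = Maps-enumerates }

module _ {n : ℕ} (F : FigureSet n) where
  open Figures F

  W-permute : ∀ {N} {σ : Perm N} → IsPermutation σ → ∀ (c : Fin N → Y F) → W F (c ∘ σ) ≡ W F c
  W-permute {N} {σ} σ-perm c = begin
    W F (c ∘ σ)                        ≡⟨ W-as-sum (c ∘ σ) ⟩
    +ᵛ-sum.∑ (allFin N) (wt F ∘ c ∘ σ)  ≡⟨ ∑-reindex (+ᵛ-commutativeMonoid n) (allFin-enumerates N) (allFin-enumerates N)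
                                            σ-bijection (wt F ∘ c) (cong (wt F ∘ c)) ⟩
    +ᵛ-sum.∑ (allFin N) (wt F ∘ c)      ≡⟨ sym (W-as-sum c) ⟩
    W F c                              ∎
    where
    open ≡-Reasoning
    σ-bijection : Bijection (Finˢ N) (Finˢ N) (λ _ → ⊤) (λ _ → ⊤)
    σ-bijection = record
      { to = σ ; from = inv σ ; to-cong = cong σ ; from-cong = cong (inv σ) ; to-P = _ ; from-P = _
      ; from∘to = λ _ → inv-left σ-perm _ ; to∘from = λ _ → inv-right σ-perm _ }

  coloringAction : ∀ {N} (H : PermutationGroup N) (e : Vec ℕ n) → Action H (Coloringˢ N) (λ c → W F c ≡ e)
  -- Carries and carries? are literally those of SameConfig / SameConfig?, so that orbit counting
  -- for the stabilizer of a map M computes numConfigs G F M e itself.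
  coloringAction {N} H e = record
    { Carries = λ γ c c′ → ∀ u → c′ (γ u) ≡ c u
    ; carries? = λ γ c c′ → all? (λ u → _≟Y_ F (c′ (γ u)) (c u))
    ; carries-cong = λ {γ} {γ′} {c} {c′} {d} {d′} γ≗ c≗ d≗ carries u →
        trans (sym (d≗ (γ′ u))) (trans (cong d (sym (γ≗ u))) (trans (carries u) (c≗ u)))
    ; carries-id = λ c u → refl
    ; carries-∘ = λ {γ} carries carries′ u → trans (carries′ (γ u)) (carries u)
    ; carries-inv = λ {γ} {c} {c′} γ∈ carries u →
        sym (trans (cong c′ (sym (inv-right (member-perm γ∈) u))) (carries (inv γ u)))
    ; carries-functional = λ {γ} {c} {c′} {c″} γ∈ carries carries′ v →
        trans (cong c′ (sym (inv-right (member-perm γ∈) v)))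
          (trans (carries (inv γ v)) (trans (sym (carries′ (inv γ v))) (cong c″ (inv-right (member-perm γ∈) v))))
    ; act = λ γ c → c ∘ inv γ
    ; act-cong = λ {γ} c≗ → c≗ ∘ inv γ
    ; act-domain = λ {γ} {c} γ∈ W≡e → trans (W-permute (inv-isPermutation (member-perm γ∈)) c) W≡e
    ; carries-act = λ {γ} {c} γ∈ _ u → cong c (inv-left (member-perm γ∈) u)
    ; points = colorings F N e
    ; points-enumerate = enumerates-⇔ (WeightedEnumeration.enumerates (coloringEnumeration N) e) proj₂ (tt ,_) }
    where open PermutationGroup H using (member-perm)

÷-cancel : ∀ d m → (∃ λ k → d ≡ suc k) → (d * m) ÷ d ≡ (+ m) / 1
÷-cancel .(suc k) m (k , refl) = fromℚᵘ-cong {ℚᵘ.mkℚᵘ (+ (suc k * m)) k} {ℚᵘ.mkℚᵘ (+ m) 0} (ℚᵘ.*≡* (begin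
  + (suc k * m) ℤ.* + 1 ≡⟨ ℤₚ.*-identityʳ _ ⟩
  + (suc k * m)         ≡⟨ cong +_ (ℕ.*-comm (suc k) m) ⟩
  + (m * suc k)         ≡⟨ ℤₚ.pos-* m (suc k) ⟩
  + m ℤ.* + suc k       ∎))
  where open ≡-Reasoning

module Imbeddings {N n : ℕ} (G : Graph N) (F : FigureSet n) (e : Vec ℕ n) where
  open Automorphisms G
  open PermutationGroup automorphismGroup using (order; order-positive)
  open OrbitCounting mapAction using (_~?_; transporters; orbit-stabilizer; ∑-by-orbits)
  open ℕ-sum using (∑; [_]·_)
  private
    module Colorings = OrbitCounting (coloringAction F automorphismGroup e)
    module Γ = Enumerates (PermutationGroup.enumerates automorphismGroup)

  numerator : ℕ
  numerator = ∑ (Aut G) (λ γ → numFixed G γ * substCycleIndex (figSeries F) γ e)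

  configurations : RotSys N → ℕ
  configurations M = numConfigs G F M e

  fixedPairs : RotSys N → ℕ
  fixedPairs = stabilizer-fixed-count mapAction (coloringAction F automorphismGroup e)

  orbitSum : RotSys N → ℕ
  orbitSum M = ∑ (Maps G) (λ ρ → [ M ~? ρ ]· fixedPairs ρ)

  numerator-over-maps : numerator ≡ ∑ (Maps G) fixedPairs
  numerator-over-maps = begin
    ∑ (Aut G) (λ γ → numFixed G γ * substCycleIndex (figSeries F) γ e)
      ≡⟨ ℕ-sum.∑-congᴬ (All.map (λ γ-aut → cong (numFixed G _ *_) (Polya.polya F _ (proj₁ γ-aut) e)) Γ.sound) ⟩
    ∑ (Aut G) (λ γ → numFixed G γ * Colorings.fixed-count γ)
      ≡⟨ ℕ-sum.∑-cong (Aut G) (λ γ →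
           trans (cong (_* Colorings.fixed-count γ) (ℕ-sum.length-filter (λ ρ → Sends? γ ρ ρ) (Maps G)))
                 (ℕ-sum.∑-[]·1-* (λ ρ → Sends? γ ρ ρ) (Maps G) _)) ⟩
    ∑ (Aut G) (λ γ → ∑ (Maps G) (λ ρ → [ Sends? γ ρ ρ ]· Colorings.fixed-count γ))
      ≡⟨ ℕ-sum.∑-comm (Aut G) (Maps G) _ ⟩
    ∑ (Maps G) fixedPairs ∎
    where open ≡-Reasoning

  private
    fixedPairs-cong : ∀ {ρ ρ′} → DecSetoid._≈_ Rotˢ ρ ρ′ → fixedPairs ρ ≡ fixedPairs ρ′
    fixedPairs-cong {ρ} {ρ′} ρ≈ = ℕ-sum.∑-cong (Aut G) (λ γ →
      ℕ-sum.[]·-⇔ (Sends? γ ρ ρ) (Sends? γ ρ′ ρ′) (Colorings.fixed-count γ)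
        (Sends-cong {γ} {γ} (λ _ → refl) ρ≈ ρ≈)
        (Sends-cong {γ} {γ} (λ _ → refl) (λ v u → sym (ρ≈ v u)) (λ v u → sym (ρ≈ v u))))

  fixedPairs-burnside : ∀ M → fixedPairs M ≡ length (MapAut G M) * configurations M
  fixedPairs-burnside M =
    trans (sym (ℕ-sum.∑-filter (λ γ → Sends? γ M M) (Aut G) Colorings.fixed-count))
          (OrbitCounting.burnside (coloringAction F (stabilizer mapAction M) e))

  orbitSum≡ : ∀ {M} → IsMap G M → orbitSum M ≡ order * configurations M
  orbitSum≡ {M} M-map with PermutationGroup.order-positive (stabilizer mapAction M)
  ... | k , |Γ_M|≡ = ℕ.*-cancelˡ-≡ _ _ (suc k) (begin
    suc k * orbitSum M
      ≡⟨ cong (_* orbitSum M) (trans (sym |Γ_M|≡) (ℕ-sum.length-filter (λ γ → Sends? γ M M) (Aut G))) ⟩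
    transporters M M * orbitSum M
      ≡⟨ orbit-stabilizer M-map fixedPairs fixedPairs-cong
           (stabilizer-fixed-count-invariant mapAction (coloringAction F automorphismGroup e)) ⟩
    order * fixedPairs M
      ≡⟨ cong (order *_) (trans (fixedPairs-burnside M) (cong (_* configurations M) |Γ_M|≡)) ⟩
    order * (suc k * configurations M)
      ≡⟨ x∙yz≈y∙xz order (suc k) (configurations M) ⟩
    suc k * (order * configurations M) ∎)
    where
    open ≡-Reasoning
    open CommSemigroupProperties ℕ.*-commutativeSemigroup using (x∙yz≈y∙xz)

  numerator≡ : ∀ R → IsImbeddingReps G R → numerator ≡ order * ∑ R configurations
  numerator≡ R (R-maps , R-distinct , R-covers) = begin
    numerator                             ≡⟨ numerator-over-maps ⟩
    ∑ (Maps G) fixedPairs                 ≡⟨ ∑-by-orbits R-maps R-distinct R-covers fixedPairs ⟩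
    ∑ R orbitSum                          ≡⟨ ℕ-sum.∑-congᴬ (All.map orbitSum≡ R-maps) ⟩
    ∑ R (λ M → order * configurations M)  ≡⟨ ℕ-sum.∑-*ˡ R order configurations ⟩
    order * ∑ R configurations            ∎
    where open ≡-Reasoning

theorem7 : ∀ {N n : ℕ} (G : Graph N) → Connected G →
           (R : List (RotSys N)) → IsImbeddingReps G R →
           (F : FigureSet n) →
           ∀ (e : Vec ℕ n) →
             ZCoeff G F e ≡ (+ sum (map (λ M → numConfigs G F M e) R)) / 1
theorem7 G _ R reps F e =
  trans (cong (_÷ length (Aut G)) (Imbeddings.numerator≡ G F e R reps))
        (÷-cancel (length (Aut G)) _ (PermutationGroup.order-positive (Automorphisms.automorphismGroup G)))
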